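{- Let $f\colon\mathbb F_2^n\to\mathbb F_2$ be a bent function and write its Smith normal form as $\operatorname{snf}(f)=\{*d_1^{m_1},\dots,d_k^{m_k},0^{2^n-1}*\}$ with $d_1,\dots,d_k$ nonzero and $d_1\mid d_2\mid\cdots\mid d_k$. Then: (1) every elementary divisor $d_i$ is a power of two; (2) $\Gamma\text{ -rank}(f)=m_1$, the multiplicity of the entry $1$ in $\operatorname{snf}(f)$.
   Context: A Boolean function $f\colon\mathbb F_2^n\to\mathbb F_2$ is bent if for every nonzero $\mathbf{a}\in\mathbb F_2^n$ and every $b\in\mathbb F_2$ the equation $f(\mathbf{x}\oplus\mathbf{a})\oplus f(\mathbf{x})=b$ has exactly $2^{n-1}$ solutions $\mathbf{x}\in\mathbb F_2^n$. The graph of $f$ is $G_f=\{(\mathbf{x},f(\mathbf{x})):\mathbf{x}\in\mathbb F_2^n\}\subseteq\mathbb F_2^{n+1}$; its development $\operatorname{dev}(G_f)$ is the incidence structure with points $\mathbb F_2^{n+1}$ and lines the translates $G_f+\mathbf{g}$, $\mathbf{g}\in\mathbb F_2^{n+1}$, and $N_f$ is its $(0,1)$ incidence matrix (rows = lines, columns = points). $\Gamma\text{ -rank}(f)$ is the rank of $N_f$ over $\mathbb F_2$, and $\operatorname{snf}(f)$ is the Smith normal form of $N_f$ over $\mathbb Z$ (the diagonal matrix $UN_fV$ with $U,V$ unimodular and diagonal entries $d_1\mid d_2\mid\cdots$), written as a multiset of diagonal entries with multiplicities. -}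

module Defs where

open import Data.Bool using (Bool; true; false; _xor_; _∧_; not; if_then_else_)
open import Data.Nat using (ℕ; zero; suc; _+_; _^_; _∸_; _≤_; _≡ᵇ_)
open import Data.Nat.Divisibility using (_∣_)
open import Data.Fin using (Fin; zero; suc; toℕ; remQuot)
open import Data.Fin.Properties using () renaming (_≟_ to _≟F_)
open import Data.Vec using (Vec; []; _∷_; zipWith; replicate)
open import Data.Integer as ℤ using (ℤ; +_)
open import Data.Product using (Σ; _×_; _,_; proj₁; proj₂)
open import Relation.Binary.PropositionalEquality using (_≡_; _≢_)
open import Relation.Nullary using (does)

F2^ : ℕ → Set
F2^ n = Vec Bool n

_⊕_ : ∀ {n} → F2^ n → F2^ n → F2^ n
_⊕_ = zipWith _xor_

zeroV : ∀ {n} → F2^ n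
zeroV = replicate _ false

eqB : Bool → Bool → Bool
eqB a b = not (a xor b)

sumℕ : ∀ {m} → (Fin m → ℕ) → ℕ
sumℕ {zero}  f = 0
sumℕ {suc m} f = f zero + sumℕ (λ i → f (suc i))

sumℤ : ∀ {m} → (Fin m → ℤ) → ℤ
sumℤ {zero}  f = + 0
sumℤ {suc m} f = f zero ℤ.+ sumℤ (λ i → f (suc i))

xorSum : ∀ {m} → (Fin m → Bool) → Bool
xorSum {zero}  f = false
xorSum {suc m} f = f zero xor xorSum (λ i → f (suc i))

countFin : ∀ {m} → (Fin m → Bool) → ℕ
countFin p = sumℕ (λ i → if p i then 1 else 0)

-- a fixed enumeration (bijection) Fin (2 ^ k) → F₂^k (binary digits)

isOne : Fin 2 → Bool
isOne zero    = false
isOne (suc _) = true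

bits : (k : ℕ) → Fin (2 ^ k) → F2^ k
bits zero    _ = []
bits (suc k) i = isOne (proj₁ (remQuot {2} (2 ^ k) i)) ∷ bits k (proj₂ (remQuot {2} (2 ^ k) i))

countV : (n : ℕ) → (F2^ n → Bool) → ℕ
countV n p = countFin (λ i → p (bits n i))

IsBent : (n : ℕ) → (F2^ n → Bool) → Set
IsBent n f =
  (a : F2^ n) → a ≢ zeroV → (b : Bool) →
  countV n (λ x → eqB (f (x ⊕ a) xor f x) b) ≡ 2 ^ (n ∸ 1)

-- points of F₂^(n+1) = F₂^n × F₂, indexed by Fin (2 ^ (n+1)) (bijection)

Pt : ℕ → Set
Pt n = F2^ n × Bool

pt : (n : ℕ) → Fin (2 ^ suc n) → Pt n
pt n i = bits n (proj₂ (remQuot {2} (2 ^ n) i)) , isOne (proj₁ (remQuot {2} (2 ^ n) i))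

_⊕ₚ_ : ∀ {n} → Pt n → Pt n → Pt n
(x , y) ⊕ₚ (x' , y') = (x ⊕ x') , (y xor y')

inGraph : (n : ℕ) → (F2^ n → Bool) → Pt n → Bool
inGraph n f (x , y) = eqB (f x) y

-- p ∈ G_f + g  ⇔  p ⊕ g ∈ G_f   (characteristic 2)
inTranslate : (n : ℕ) → (F2^ n → Bool) → (g p : Pt n) → Bool
inTranslate n f g p = inGraph n f (p ⊕ₚ g)

Mat : Set → ℕ → Set
Mat A m = Fin m → Fin m → A

-- incidence matrix N_f of dev(G_f): rows = lines G_f + g, columns = points p
-- (both indexed by Fin (2 ^ (n+1)) via pt)
NfB : (n : ℕ) → (F2^ n → Bool) → Mat Bool (2 ^ suc n)
NfB n f i j = inTranslate n f (pt n i) (pt n j)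

Nf : (n : ℕ) → (F2^ n → Bool) → Mat ℤ (2 ^ suc n)
Nf n f i j = if NfB n f i j then + 1 else + 0

_⊛_ : ∀ {m} → Mat ℤ m → Mat ℤ m → Mat ℤ m
(A ⊛ B) i j = sumℤ (λ k → A i k ℤ.* B k j)

idMat : ∀ {m} → Mat ℤ m
idMat i j = if does (i ≟F j) then + 1 else + 0

Unimodular : ∀ {m} → Mat ℤ m → Set
Unimodular {m} U =
  Σ (Mat ℤ m) λ W → (∀ i j → (U ⊛ W) i j ≡ idMat i j) × (∀ i j → (W ⊛ U) i j ≡ idMat i j)

IsSNF : ∀ {m} → Mat ℤ m → (U V : Mat ℤ m) → (d : Fin m → ℕ) → Set
IsSNF {m} N U V d =
  Unimodular U × Unimodular V ×
  (∀ i j → ((U ⊛ N) ⊛ V) i j ≡ (if does (i ≟F j) then + d i else + 0)) ×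
  (∀ i j → toℕ i ≤ toℕ j → d i ∣ d j)

rowSum : ∀ {m} → Mat Bool m → (Fin m → Bool) → Fin m → Bool
rowSum M T j = xorSum (λ i → T i ∧ M i j)

LinIndepRows : ∀ {m} → Mat Bool m → (Fin m → Bool) → Set
LinIndepRows M S =
  ∀ T → (∀ i → T i ≡ true → S i ≡ true) → (∀ j → rowSum M T j ≡ false) →
  ∀ i → T i ≡ false

HasRankF2 : ∀ {m} → Mat Bool m → ℕ → Set
HasRankF2 {m} M r =
  (Σ (Fin m → Bool) λ S → LinIndepRows M S × countFin S ≡ r) ×
  (∀ S → LinIndepRows M S → countFin S ≤ r)

module Submission where

-- N_f is the translation matrix (h (p_j + p_i)) of the indicator h of the graph of f, and products of
-- translation matrices are translation matrices of correlations (a ⋆ b)(z) = Σ_q a(q) b(q + z).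
-- Bentness says that 2 (h ⋆ h)(a, b) is 2^n for a ≠ 0, and 2^(n+1) [b = 0] for a = 0; from this, for X
-- the translation matrix of 2^(n+1) h + 1 − 2^n, one gets N X N = 2^(2n+1) N.  If U N V = D = diag(d)
-- with U, V unimodular, then D (V⁻¹ X U⁻¹) D = 2^(2n+1) D, so d_i² Y_ii = 2^(2n+1) d_i and every
-- nonzero d_i divides 2^(2n+1).  Reducing U N V = D modulo 2 makes N_f over F₂ equivalent to the
-- diagonal matrix of the d_i mod 2, which is 1 exactly when d_i = 1 since every d_i is 0 or a power
-- of two; by the Steinitz exchange lemma the rank of such a matrix is its number of nonzero entries.

open import Defs
open import Data.Bool using (Bool)
open import Data.Nat using (ℕ; suc; _^_; _≡ᵇ_)
open import Data.Fin using (Fin)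
open import Data.Integer using (ℤ)
open import Data.Product using (_×_; ∃)
open import Relation.Binary.PropositionalEquality using (_≡_; _≢_)

open import Level using (0ℓ)
open import Algebra.Bundles using (CommutativeSemiring)

module SquareMatrices (R : CommutativeSemiring 0ℓ 0ℓ) where

  open import Data.Bool using (if_then_else_)
  open import Data.Nat as ℕ using (ℕ; zero; suc)
  open import Data.Fin using (Fin; zero; suc; _↑ˡ_; _↑ʳ_; combine)
  open import Data.Fin.Properties using (_≟_)
  open import Relation.Binary.Bundles using (Setoid)
  import Relation.Binary.Reasoning.Setoid
  open import Relation.Binary.PropositionalEquality as ≡ using (_≡_)
  open import Relation.Nullary using (does; yes; no)
  open import Data.Empty using (⊥-elim)

  open CommutativeSemiring R hiding (zero)
  open import Algebra.Properties.Semiring.Sum semiring public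
    using (sum; sum-syntax; sum-cong-≋; sum-replicate-zero; ∑-distrib-+; ∑-comm; *-distribˡ-sum; *-distribʳ-sum)
  open import Algebra.Properties.CommutativeSemigroup *-commutativeSemigroup using (x∙yz≈y∙xz)
  private
    module ≈-Reasoning = Relation.Binary.Reasoning.Setoid setoid

  Matrix : ℕ → Set
  Matrix m = Fin m → Fin m → Carrier

  infix 4 _≈ᴹ_
  infixl 7 _*ᴹ_

  _≈ᴹ_ : ∀ {m} → Matrix m → Matrix m → Set
  X ≈ᴹ Y = ∀ i j → X i j ≈ Y i j

  ≈ᴹ-setoid : ℕ → Setoid 0ℓ 0ℓ
  ≈ᴹ-setoid m = record
    { Carrier = Matrix m
    ; _≈_ = _≈ᴹ_
    ; isEquivalence = record
      { refl = λ i j → refl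
      ; sym = λ X≈Y i j → sym (X≈Y i j)
      ; trans = λ X≈Y Y≈Z i j → trans (X≈Y i j) (Y≈Z i j)
      }
    }

  sum-↑ : ∀ a b (f : Fin (a ℕ.+ b) → Carrier) → sum f ≈ sum (λ i → f (i ↑ˡ b)) + sum (λ i → f (a ↑ʳ i))
  sum-↑ zero b f = sym (+-identityˡ _)
  sum-↑ (suc a) b f = trans (+-congˡ (sum-↑ a b (λ i → f (suc i)))) (sym (+-assoc (f zero) _ _))

  sum-combine : ∀ a b (f : Fin (a ℕ.* b) → Carrier) → sum f ≈ ∑[ i < a ] ∑[ j < b ] f (combine i j)
  sum-combine zero b f = refl
  sum-combine (suc a) b f = trans (sum-↑ b (a ℕ.* b) f) (+-congˡ (sum-combine a b (λ i → f (b ↑ʳ i))))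

  module ≈ᴹ-Reasoning (m : ℕ) = Relation.Binary.Reasoning.Setoid (≈ᴹ-setoid m)

  1ᴹ : ∀ {m} → Matrix m
  1ᴹ i j = if does (i ≟ j) then 1# else 0#

  _*ᴹ_ : ∀ {m} → Matrix m → Matrix m → Matrix m
  _*ᴹ_ {m} X Y i j = ∑[ k < m ] (X i k * Y k j)

  1ᴹ-diagonal : ∀ {m} (i : Fin m) → 1ᴹ i i ≡ 1#
  1ᴹ-diagonal i with i ≟ i
  ... | yes _ = ≡.refl
  ... | no i≢i = ⊥-elim (i≢i ≡.refl)

  1ᴹ-sym : ∀ {m} (i j : Fin m) → 1ᴹ i j ≡ 1ᴹ j i
  1ᴹ-sym i j with i ≟ j | j ≟ i
  ... | yes _   | yes _   = ≡.refl
  ... | no _    | no _    = ≡.refl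
  ... | yes i≡j | no j≢i  = ⊥-elim (j≢i (≡.sym i≡j))
  ... | no i≢j  | yes j≡i = ⊥-elim (i≢j (≡.sym j≡i))

  1ᴹ-suc : ∀ {m} (i j : Fin m) → 1ᴹ (suc i) (suc j) ≡ 1ᴹ i j
  1ᴹ-suc i j with i ≟ j
  ... | yes _ = ≡.refl
  ... | no _  = ≡.refl

  ∑-1ᴹˡ : ∀ {m} (j : Fin m) (f : Fin m → Carrier) → ∑[ k < m ] (1ᴹ j k * f k) ≈ f j
  ∑-1ᴹˡ {suc m} zero f = begin
    1# * f zero + ∑[ k < m ] (0# * f (suc k)) ≈⟨ +-cong (*-identityˡ _) (sum-cong-≋ (λ k → zeroˡ (f (suc k)))) ⟩
    f zero + ∑[ k < m ] 0#                    ≈⟨ +-congˡ (sum-replicate-zero m) ⟩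
    f zero + 0#                               ≈⟨ +-identityʳ _ ⟩
    f zero                                    ∎
    where open ≈-Reasoning
  ∑-1ᴹˡ {suc m} (suc j) f = begin
    0# * f zero + ∑[ k < m ] (1ᴹ (suc j) (suc k) * f (suc k)) ≈⟨ +-cong (zeroˡ _) (sum-cong-≋ λ k → *-congʳ (reflexive (1ᴹ-suc j k))) ⟩
    0# + ∑[ k < m ] (1ᴹ j k * f (suc k))                      ≈⟨ +-identityˡ _ ⟩
    ∑[ k < m ] (1ᴹ j k * f (suc k))                           ≈⟨ ∑-1ᴹˡ j (λ k → f (suc k)) ⟩
    f (suc j)                                                 ∎
    where open ≈-Reasoning

  ∑-1ᴹʳ : ∀ {m} (j : Fin m) (f : Fin m → Carrier) → ∑[ k < m ] (f k * 1ᴹ k j) ≈ f j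
  ∑-1ᴹʳ j f = trans (sum-cong-≋ λ k → trans (*-comm _ _) (*-congʳ (reflexive (1ᴹ-sym k j)))) (∑-1ᴹˡ j f)

  *ᴹ-identityˡ : ∀ {m} (X : Matrix m) → 1ᴹ *ᴹ X ≈ᴹ X
  *ᴹ-identityˡ X i j = ∑-1ᴹˡ i (λ k → X k j)

  *ᴹ-identityʳ : ∀ {m} (X : Matrix m) → X *ᴹ 1ᴹ ≈ᴹ X
  *ᴹ-identityʳ X i j = ∑-1ᴹʳ j (X i)

  *ᴹ-congˡ : ∀ {m} (X : Matrix m) {Y Y′ : Matrix m} → Y ≈ᴹ Y′ → X *ᴹ Y ≈ᴹ X *ᴹ Y′
  *ᴹ-congˡ X Y≈Y′ i j = sum-cong-≋ λ k → *-congˡ (Y≈Y′ k j)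

  *ᴹ-congʳ : ∀ {m} {X X′ : Matrix m} (Y : Matrix m) → X ≈ᴹ X′ → X *ᴹ Y ≈ᴹ X′ *ᴹ Y
  *ᴹ-congʳ Y X≈X′ i j = sum-cong-≋ λ k → *-congʳ (X≈X′ i k)

  *ᴹ-assoc : ∀ {m} (X Y Z : Matrix m) → (X *ᴹ Y) *ᴹ Z ≈ᴹ X *ᴹ (Y *ᴹ Z)
  *ᴹ-assoc {m} X Y Z i j = begin
    ∑[ k < m ] (∑[ l < m ] (X i l * Y l k) * Z k j) ≈⟨ sum-cong-≋ (λ k → *-distribʳ-sum (Z k j) (λ l → X i l * Y l k)) ⟩
    ∑[ k < m ] ∑[ l < m ] (X i l * Y l k * Z k j)   ≈⟨ ∑-comm (λ k l → X i l * Y l k * Z k j) ⟩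
    ∑[ l < m ] ∑[ k < m ] (X i l * Y l k * Z k j)   ≈⟨ sum-cong-≋ (λ l → sum-cong-≋ {m} λ k → *-assoc (X i l) (Y l k) (Z k j)) ⟩
    ∑[ l < m ] ∑[ k < m ] (X i l * (Y l k * Z k j)) ≈⟨ sum-cong-≋ (λ l → sym (*-distribˡ-sum (X i l) (λ k → Y l k * Z k j))) ⟩
    ∑[ l < m ] (X i l * ∑[ k < m ] (Y l k * Z k j)) ∎
    where open ≈-Reasoning

  infixr 8 _·ᴹ_

  _·ᴹ_ : ∀ {m} → Carrier → Matrix m → Matrix m
  (c ·ᴹ X) i j = c * X i j

  *ᴹ-·ᴹ : ∀ {m} (X Y : Matrix m) c → X *ᴹ c ·ᴹ Y ≈ᴹ c ·ᴹ (X *ᴹ Y)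
  *ᴹ-·ᴹ {m} X Y c i j = begin
    ∑[ k < m ] (X i k * (c * Y k j)) ≈⟨ sum-cong-≋ (λ k → x∙yz≈y∙xz (X i k) c (Y k j)) ⟩
    ∑[ k < m ] (c * (X i k * Y k j)) ≈⟨ *-distribˡ-sum c (λ k → X i k * Y k j) ⟨
    c * ∑[ k < m ] (X i k * Y k j)   ∎
    where open ≈-Reasoning

  ·ᴹ-*ᴹ : ∀ {m} c (X Y : Matrix m) → (c ·ᴹ X) *ᴹ Y ≈ᴹ c ·ᴹ (X *ᴹ Y)
  ·ᴹ-*ᴹ {m} c X Y i j = begin
    ∑[ k < m ] (c * X i k * Y k j)   ≈⟨ sum-cong-≋ (λ k → *-assoc c (X i k) (Y k j)) ⟩
    ∑[ k < m ] (c * (X i k * Y k j)) ≈⟨ *-distribˡ-sum c (λ k → X i k * Y k j) ⟨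
    c * ∑[ k < m ] (X i k * Y k j)   ∎
    where open ≈-Reasoning

  diagᴹ : ∀ {m} → (Fin m → Carrier) → Matrix m
  diagᴹ a i j = 1ᴹ i j * a i

  diagᴹ-*ᴹ : ∀ {m} (a : Fin m → Carrier) (X : Matrix m) i j → (diagᴹ a *ᴹ X) i j ≈ a i * X i j
  diagᴹ-*ᴹ {m} a X i j = begin
    ∑[ k < m ] (1ᴹ i k * a i * X k j)   ≈⟨ sum-cong-≋ (λ k → *-assoc (1ᴹ i k) (a i) (X k j)) ⟩
    ∑[ k < m ] (1ᴹ i k * (a i * X k j)) ≈⟨ ∑-1ᴹˡ i (λ k → a i * X k j) ⟩
    a i * X i j                         ∎
    where open ≈-Reasoning

  *ᴹ-diagᴹ : ∀ {m} (X : Matrix m) (a : Fin m → Carrier) i j → (X *ᴹ diagᴹ a) i j ≈ X i j * a j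
  *ᴹ-diagᴹ {m} X a i j = begin
    ∑[ k < m ] (X i k * (1ᴹ k j * a k)) ≈⟨ sum-cong-≋ (λ k → x∙yz≈y∙xz (X i k) (1ᴹ k j) (a k)) ⟩
    ∑[ k < m ] (1ᴹ k j * (X i k * a k)) ≈⟨ sum-cong-≋ (λ k → *-congʳ (reflexive (1ᴹ-sym k j))) ⟩
    ∑[ k < m ] (1ᴹ j k * (X i k * a k)) ≈⟨ ∑-1ᴹˡ j (λ k → X i k * a k) ⟩
    X i j * a j                         ∎
    where open ≈-Reasoning

  *ᴹ-cancel-middle : ∀ {m} {P Q : Matrix m} → P *ᴹ Q ≈ᴹ 1ᴹ → ∀ A B → A *ᴹ P *ᴹ (Q *ᴹ B) ≈ᴹ A *ᴹ B
  *ᴹ-cancel-middle {m} {P} {Q} PQ≈1 A B = begin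
    A *ᴹ P *ᴹ (Q *ᴹ B)   ≈⟨ *ᴹ-assoc A P (Q *ᴹ B) ⟩
    A *ᴹ (P *ᴹ (Q *ᴹ B)) ≈⟨ *ᴹ-congˡ A (*ᴹ-assoc P Q B) ⟨
    A *ᴹ (P *ᴹ Q *ᴹ B)   ≈⟨ *ᴹ-congˡ A (*ᴹ-congʳ B PQ≈1) ⟩
    A *ᴹ (1ᴹ *ᴹ B)       ≈⟨ *ᴹ-congˡ A (*ᴹ-identityˡ B) ⟩
    A *ᴹ B               ∎
    where open ≈ᴹ-Reasoning m

module RankOverF₂ where

  open import Algebra.Bundles using (CommutativeRing)
  open import Data.Bool using (Bool; true; false; _xor_; _∧_; _∨_; not; if_then_else_)
  open import Data.Bool.Properties
    using (_≟_; xor-∧-commutativeRing; ∧-conicalˡ; ∧-conicalʳ; ∧-identityʳ; ∧-zeroʳ; ∧-assoc; ∧-distribʳ-xor;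
           ∨-zeroʳ; ∨-identityʳ; xor-same; xor-identityʳ; ¬-not; not-involutive)
  open import Data.Nat using (ℕ; zero; suc; _+_; _≤_; z≤n; s≤s)
  open import Data.Nat.Properties using (≤-antisym; m≤n⇒m≤1+n; suc-injective; +-identityʳ; +-suc; ≤-refl; ≤-trans; <-irrefl)
  open import Data.Fin using (Fin; zero; suc)
  open import Data.Product using (Σ; _×_; _,_; proj₁; proj₂; ∃)
  open import Data.Empty using (⊥-elim)
  open import Relation.Nullary using (Dec; yes; no; ¬_)
  open import Data.Fin.Properties using (any?; all?; ¬∀⟶∃¬) renaming (_≟_ to _≟ᶠ_)
  open import Data.Fin.Subset.Properties using (anySubset?)
  open import Data.Vec using (lookup; tabulate)
  open import Data.Vec.Properties using (lookup∘tabulate)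
  open import Relation.Nullary.Decidable using (_×-dec_; _→-dec_; map′)
  open import Relation.Binary.PropositionalEquality

  open SquareMatrices (CommutativeRing.commutativeSemiring xor-∧-commutativeRing) public

  true≢false : true ≢ false
  true≢false ()

  xorSum≗sum : ∀ {m} (f : Fin m → Bool) → xorSum f ≡ sum f
  xorSum≗sum {zero} f = refl
  xorSum≗sum {suc m} f = cong (f zero xor_) (xorSum≗sum (λ i → f (suc i)))

  module _ {m : ℕ} where

    infix 4 _⊆_

    _⊆_ : (Fin m → Bool) → (Fin m → Bool) → Set
    T ⊆ S = ∀ i → T i ≡ true → S i ≡ true

    ∅ : Fin m → Bool
    ∅ _ = false

    ⁅_⁆ : Fin m → Fin m → Bool
    ⁅ i ⁆ = 1ᴹ i

    remove : (Fin m → Bool) → Fin m → Fin m → Bool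
    remove S i k = S k ∧ not (⁅ i ⁆ k)

    insert : (Fin m → Bool) → Fin m → Fin m → Bool
    insert S i k = S k ∨ ⁅ i ⁆ k

  ⁅⁆-self : ∀ {m} (i : Fin m) → ⁅ i ⁆ i ≡ true
  ⁅⁆-self = 1ᴹ-diagonal

  ⁅⁆⇒≡ : ∀ {m} {i k : Fin m} → ⁅ i ⁆ k ≡ true → i ≡ k
  ⁅⁆⇒≡ {i = i} {k} e with i ≟ᶠ k
  ... | yes i≡k = i≡k
  ⁅⁆⇒≡ () | no _

  ⁅⁆-suc : ∀ {m} (i k : Fin m) → ⁅ suc i ⁆ (suc k) ≡ ⁅ i ⁆ k
  ⁅⁆-suc = 1ᴹ-suc

  remove-self : ∀ {m} (S : Fin m → Bool) i → remove S i i ≡ false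
  remove-self S i = trans (cong (λ b → S i ∧ not b) (⁅⁆-self i)) (∧-zeroʳ (S i))

  remove-suc : ∀ {m} (S : Fin (suc m) → Bool) i k → remove (λ k → S (suc k)) i k ≡ remove S (suc i) (suc k)
  remove-suc S i k = cong (λ b → S (suc k) ∧ not b) (sym (⁅⁆-suc i k))

  remove-⊆ : ∀ {m} (S : Fin m → Bool) i → remove S i ⊆ S
  remove-⊆ S i k e = ∧-conicalˡ (S k) _ e

  ⊆-remove : ∀ {m} {T S : Fin m → Bool} {i} → T ⊆ S → T i ≡ false → T ⊆ remove S i
  ⊆-remove {T = T} {S} {i} T⊆S Ti k Tk with ⁅ i ⁆ k in e
  ... | false = trans (∧-identityʳ (S k)) (T⊆S k Tk)
  ... | true = ⊥-elim (true≢false (trans (sym Tk) (subst (λ x → T x ≡ false) (⁅⁆⇒≡ e) Ti)))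

  ⊆-false : ∀ {m} {T S : Fin m → Bool} {i} → T ⊆ S → S i ≡ false → T i ≡ false
  ⊆-false {T = T} {i = i} T⊆S Si with T i in e
  ... | false = refl
  ... | true = sym (trans (sym Si) (T⊆S i e))

  ⁅⁆-⊆ : ∀ {m} {S : Fin m → Bool} {i} → S i ≡ true → ⁅ i ⁆ ⊆ S
  ⁅⁆-⊆ {S = S} Si k e = subst (λ x → S x ≡ true) (⁅⁆⇒≡ e) Si

  ⊆-xor : ∀ {m} {T T′ S : Fin m → Bool} → T ⊆ S → T′ ⊆ S → (λ i → T i xor T′ i) ⊆ S
  ⊆-xor {T = T} T⊆S T′⊆S i e with T i in Ti
  ... | true = T⊆S i Ti
  ... | false = T′⊆S i e

  ⊆-∧ : ∀ {m} {T S : Fin m → Bool} c → T ⊆ S → (λ i → c ∧ T i) ⊆ S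
  ⊆-∧ c T⊆S i e = T⊆S i (∧-conicalʳ c _ e)

  countFin-cong : ∀ {m} {S T : Fin m → Bool} → (∀ i → S i ≡ T i) → countFin S ≡ countFin T
  countFin-cong {zero} S≗T = refl
  countFin-cong {suc m} {S} {T} S≗T = cong₂ (λ b n → (if b then 1 else 0) + n) (S≗T zero) (countFin-cong (λ i → S≗T (suc i)))

  countFin-∅ : ∀ {m} → countFin (∅ {m}) ≡ 0
  countFin-∅ {zero} = refl
  countFin-∅ {suc m} = countFin-∅ {m}

  countFin≡0⇒∅ : ∀ {m} (S : Fin m → Bool) → countFin S ≡ 0 → ∀ i → S i ≡ false
  countFin≡0⇒∅ {suc m} S eq i with S zero in e
  countFin≡0⇒∅ {suc m} S eq zero    | false = e
  countFin≡0⇒∅ {suc m} S eq (suc i) | false = countFin≡0⇒∅ (λ k → S (suc k)) eq i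

  countFin≡suc⇒∃ : ∀ {m} (S : Fin m → Bool) {k} → countFin S ≡ suc k → ∃ λ i → S i ≡ true
  countFin≡suc⇒∃ {zero} S ()
  countFin≡suc⇒∃ {suc m} S eq with S zero in e
  ... | true = zero , e
  ... | false = let (i , Si) = countFin≡suc⇒∃ (λ k → S (suc k)) eq in suc i , Si

  countFin-≤ : ∀ {m} (S : Fin m → Bool) → countFin S ≤ m
  countFin-≤ {zero} S = z≤n
  countFin-≤ {suc m} S with S zero
  ... | true = s≤s (countFin-≤ (λ k → S (suc k)))
  ... | false = m≤n⇒m≤1+n (countFin-≤ (λ k → S (suc k)))

  countFin-remove : ∀ {m} (S : Fin m → Bool) i → S i ≡ true → countFin S ≡ suc (countFin (remove S i))
  countFin-remove {suc m} S zero e rewrite e =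
    cong suc (countFin-cong (λ k → sym (∧-identityʳ (S (suc k)))))
  countFin-remove {suc m} S (suc i) e with S zero
  ... | true  = cong suc (trans (countFin-remove (λ k → S (suc k)) i e) (cong suc (countFin-cong (remove-suc S i))))
  ... | false = trans (countFin-remove (λ k → S (suc k)) i e) (cong suc (countFin-cong (remove-suc S i)))

  countFin-insert : ∀ {m} (S : Fin m → Bool) i → S i ≡ false → countFin (insert S i) ≡ suc (countFin S)
  countFin-insert S i Si = trans (countFin-remove (insert S i) i inserted) (cong suc (countFin-cong removeInsert))
    where
    inserted : S i ∨ ⁅ i ⁆ i ≡ true
    inserted = trans (cong (S i ∨_) (⁅⁆-self i)) (∨-zeroʳ (S i))
    removeInsert : ∀ k → (S k ∨ ⁅ i ⁆ k) ∧ not (⁅ i ⁆ k) ≡ S k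
    removeInsert k with ⁅ i ⁆ k in e
    ... | false = trans (∧-identityʳ _) (∨-identityʳ (S k))
    ... | true = trans (∧-zeroʳ _) (sym (subst (λ x → S x ≡ false) (⁅⁆⇒≡ e) Si))

  module _ {m : ℕ} (M : Matrix m) where

    rowSum≡sum : ∀ T j → rowSum M T j ≡ ∑[ i < m ] (T i ∧ M i j)
    rowSum≡sum T j = xorSum≗sum (λ i → T i ∧ M i j)

    rowSum-cong : ∀ {T T′} → (∀ i → T i ≡ T′ i) → ∀ j → rowSum M T j ≡ rowSum M T′ j
    rowSum-cong {T} {T′} T≗T′ j = begin
      rowSum M T j                ≡⟨ rowSum≡sum T j ⟩
      ∑[ i < m ] (T i ∧ M i j)    ≡⟨ sum-cong-≋ (λ i → cong (_∧ M i j) (T≗T′ i)) ⟩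
      ∑[ i < m ] (T′ i ∧ M i j)   ≡⟨ rowSum≡sum T′ j ⟨
      rowSum M T′ j               ∎
      where open ≡-Reasoning

    rowSum-xor : ∀ T T′ j → rowSum M (λ i → T i xor T′ i) j ≡ rowSum M T j xor rowSum M T′ j
    rowSum-xor T T′ j = begin
      rowSum M (λ i → T i xor T′ i) j                         ≡⟨ rowSum≡sum _ j ⟩
      ∑[ i < m ] ((T i xor T′ i) ∧ M i j)                     ≡⟨ sum-cong-≋ (λ i → ∧-distribʳ-xor (M i j) (T i) (T′ i)) ⟩
      ∑[ i < m ] ((T i ∧ M i j) xor (T′ i ∧ M i j))           ≡⟨ ∑-distrib-+ (λ i → T i ∧ M i j) (λ i → T′ i ∧ M i j) ⟩
      ∑[ i < m ] (T i ∧ M i j) xor ∑[ i < m ] (T′ i ∧ M i j)  ≡⟨ cong₂ _xor_ (rowSum≡sum T j) (rowSum≡sum T′ j) ⟨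
      rowSum M T j xor rowSum M T′ j                          ∎
      where open ≡-Reasoning

    rowSum-∧ : ∀ c T j → rowSum M (λ i → c ∧ T i) j ≡ c ∧ rowSum M T j
    rowSum-∧ c T j = begin
      rowSum M (λ i → c ∧ T i) j      ≡⟨ rowSum≡sum _ j ⟩
      ∑[ i < m ] ((c ∧ T i) ∧ M i j)  ≡⟨ sum-cong-≋ (λ i → ∧-assoc c (T i) (M i j)) ⟩
      ∑[ i < m ] (c ∧ (T i ∧ M i j))  ≡⟨ *-distribˡ-sum c (λ i → T i ∧ M i j) ⟨
      c ∧ ∑[ i < m ] (T i ∧ M i j)    ≡⟨ cong (c ∧_) (rowSum≡sum T j) ⟨
      c ∧ rowSum M T j                ∎
      where open ≡-Reasoning

    rowSum-⁅⁆ : ∀ k j → rowSum M ⁅ k ⁆ j ≡ M k j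
    rowSum-⁅⁆ k j = trans (rowSum≡sum ⁅ k ⁆ j) (∑-1ᴹˡ k (λ i → M i j))

    rowSum-∅ : ∀ j → rowSum M ∅ j ≡ false
    rowSum-∅ j = trans (rowSum≡sum ∅ j) (sum-replicate-zero m)

    rowSum-addMultiple : ∀ (c w : Fin m → Bool) Q j →
      rowSum (λ i j → M i j xor (c i ∧ w j)) Q j ≡ rowSum M Q j xor (xorSum (λ i → Q i ∧ c i) ∧ w j)
    rowSum-addMultiple c w Q j = begin
      rowSum (λ i j → M i j xor (c i ∧ w j)) Q j                    ≡⟨ xorSum≗sum (λ i → Q i ∧ (M i j xor (c i ∧ w j))) ⟩
      ∑[ i < m ] (Q i ∧ (M i j xor (c i ∧ w j)))                    ≡⟨ sum-cong-≋ (λ i → distribute (Q i) (M i j) (c i) (w j)) ⟩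
      ∑[ i < m ] ((Q i ∧ M i j) xor ((Q i ∧ c i) ∧ w j))            ≡⟨ ∑-distrib-+ (λ i → Q i ∧ M i j) (λ i → (Q i ∧ c i) ∧ w j) ⟩
      ∑[ i < m ] (Q i ∧ M i j) xor ∑[ i < m ] ((Q i ∧ c i) ∧ w j)   ≡⟨ cong (∑[ i < m ] (Q i ∧ M i j) xor_) (*-distribʳ-sum (w j) (λ i → Q i ∧ c i)) ⟨
      ∑[ i < m ] (Q i ∧ M i j) xor (∑[ i < m ] (Q i ∧ c i) ∧ w j)   ≡⟨ cong₂ (λ a b → a xor (b ∧ w j)) (rowSum≡sum Q j) (xorSum≗sum (λ i → Q i ∧ c i)) ⟨
      rowSum M Q j xor (xorSum (λ i → Q i ∧ c i) ∧ w j)             ∎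
      where
      open ≡-Reasoning
      distribute : ∀ q v a b → q ∧ (v xor (a ∧ b)) ≡ (q ∧ v) xor ((q ∧ a) ∧ b)
      distribute false v a b = refl
      distribute true  v a b = refl

  *ᴹ≡rowSum : ∀ {m} (C X : Matrix m) i j → (C *ᴹ X) i j ≡ rowSum X (C i) j
  *ᴹ≡rowSum C X i j = sym (rowSum≡sum X (C i) j)

  rowSum-congᴹ : ∀ {m} {M M′ : Matrix m} → M ≈ᴹ M′ → ∀ Q j → rowSum M Q j ≡ rowSum M′ Q j
  rowSum-congᴹ {M = M} {M′} M≈M′ Q j = begin
    rowSum M Q j               ≡⟨ rowSum≡sum M Q j ⟩
    ∑[ i < _ ] (Q i ∧ M i j)   ≡⟨ sum-cong-≋ (λ i → cong (Q i ∧_) (M≈M′ i j)) ⟩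
    ∑[ i < _ ] (Q i ∧ M′ i j)  ≡⟨ rowSum≡sum M′ Q j ⟨
    rowSum M′ Q j              ∎
    where open ≡-Reasoning

  rowSum-*ᴹ : ∀ {m} (X Y : Matrix m) Q j → rowSum (X *ᴹ Y) Q j ≡ rowSum Y (λ l → rowSum X Q l) j
  rowSum-*ᴹ X Y Q j = begin
    rowSum (X *ᴹ Y) Q j                  ≡⟨ *ᴹ≡rowSum (λ _ → Q) (X *ᴹ Y) j j ⟨
    ((λ _ → Q) *ᴹ (X *ᴹ Y)) j j          ≡⟨ *ᴹ-assoc (λ _ → Q) X Y j j ⟨
    (((λ _ → Q) *ᴹ X) *ᴹ Y) j j          ≡⟨ *ᴹ≡rowSum ((λ _ → Q) *ᴹ X) Y j j ⟩
    rowSum Y (((λ _ → Q) *ᴹ X) j) j      ≡⟨ rowSum-cong Y (*ᴹ≡rowSum (λ _ → Q) X j) j ⟩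
    rowSum Y (λ l → rowSum X Q l) j      ∎
    where open ≡-Reasoning

  rowSum-1ᴹ : ∀ {m} (Q : Fin m → Bool) j → rowSum 1ᴹ Q j ≡ Q j
  rowSum-1ᴹ Q j = trans (rowSum≡sum 1ᴹ Q j) (∑-1ᴹʳ j Q)

  xorSum≡true⇒∃ : ∀ {m} (f : Fin m → Bool) → xorSum f ≡ true → ∃ λ i → f i ≡ true
  xorSum≡true⇒∃ {suc m} f e with f zero in f₀
  ... | true = zero , f₀
  ... | false = let (i , fi) = xorSum≡true⇒∃ (λ i → f (suc i)) e in suc i , fi

  rowSum-⊆ : ∀ {m} {C : Matrix m} {S} → (∀ i → C i ⊆ S) → ∀ Q → (λ l → rowSum C Q l) ⊆ S
  rowSum-⊆ {C = C} C⊆S Q l e = let (i , QiCil) = xorSum≡true⇒∃ (λ i → Q i ∧ C i l) e in C⊆S i l (∧-conicalʳ (Q i) _ QiCil)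

  module _ {m : ℕ} where

    Combination : Matrix m → (Fin m → Bool) → (Fin m → Bool) → (Fin m → Bool) → Set
    Combination W R T u = T ⊆ R × (∀ j → rowSum W T j ≡ u j)

    InSpan : Matrix m → (Fin m → Bool) → (Fin m → Bool) → Set
    InSpan W R u = Σ (Fin m → Bool) λ T → Combination W R T u

    combination-eliminate : ∀ {W R t t₀ u u₀} j₀ → Combination W R t u → Combination W R t₀ u₀ → t₀ j₀ ≡ true →
      Combination W (remove R j₀) (λ l → t l xor (t j₀ ∧ t₀ l)) (λ j → u j xor (t j₀ ∧ u₀ j))
    combination-eliminate {W} {R} {t} {t₀} j₀ (t⊆R , t≈u) (t₀⊆R , t₀≈u₀) t₀j₀ =
      ⊆-remove (⊆-xor t⊆R (⊆-∧ (t j₀) t₀⊆R)) eliminated , sums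
      where
      eliminated : t j₀ xor (t j₀ ∧ t₀ j₀) ≡ false
      eliminated = trans (cong (λ b → t j₀ xor (t j₀ ∧ b)) t₀j₀)
                         (trans (cong (t j₀ xor_) (∧-identityʳ (t j₀))) (xor-same (t j₀)))
      sums : ∀ j → rowSum W (λ l → t l xor (t j₀ ∧ t₀ l)) j ≡ _
      sums j = trans (rowSum-xor W t (λ l → t j₀ ∧ t₀ l) j)
                     (cong₂ _xor_ (t≈u j) (trans (rowSum-∧ W (t j₀) t₀ j) (cong (t j₀ ∧_) (t₀≈u₀ j))))

    LinIndepRows⇒nonzero : ∀ {V : Matrix m} {S i} → LinIndepRows V S → S i ≡ true → ¬ (∀ j → V i j ≡ false)
    LinIndepRows⇒nonzero {V} {S} {i} indep Si Vi≡0 = true≢false (trans (sym (⁅⁆-self i)) (indep ⁅ i ⁆ (⁅⁆-⊆ Si) sums i))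
      where
      sums : ∀ j → rowSum V ⁅ i ⁆ j ≡ false
      sums j = trans (rowSum-⁅⁆ V i j) (Vi≡0 j)

    -- A dependency Q among the new rows is the dependency Q + σ ⁅ i₀ ⁆ among the old ones.
    LinIndepRows-addMultiple : ∀ {V : Matrix m} {S i₀} (c : Fin m → Bool) → LinIndepRows V S → S i₀ ≡ true →
      LinIndepRows (λ i j → V i j xor (c i ∧ V i₀ j)) (remove S i₀)
    LinIndepRows-addMultiple {V} {S} {i₀} c indep Si₀ Q Q⊆ Q-sum = Q≡∅
      where
      σ = xorSum (λ i → Q i ∧ c i)
      Q′ : Fin m → Bool
      Q′ i = Q i xor (σ ∧ ⁅ i₀ ⁆ i)
      Q′⊆S : Q′ ⊆ S
      Q′⊆S = ⊆-xor (λ i e → remove-⊆ S i₀ i (Q⊆ i e)) (⊆-∧ σ (⁅⁆-⊆ Si₀))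
      Q′-sum : ∀ j → rowSum V Q′ j ≡ false
      Q′-sum j = begin
        rowSum V Q′ j                                       ≡⟨ rowSum-xor V Q (λ i → σ ∧ ⁅ i₀ ⁆ i) j ⟩
        rowSum V Q j xor rowSum V (λ i → σ ∧ ⁅ i₀ ⁆ i) j    ≡⟨ cong (rowSum V Q j xor_) (rowSum-∧ V σ ⁅ i₀ ⁆ j) ⟩
        rowSum V Q j xor (σ ∧ rowSum V ⁅ i₀ ⁆ j)            ≡⟨ cong (λ b → rowSum V Q j xor (σ ∧ b)) (rowSum-⁅⁆ V i₀ j) ⟩
        rowSum V Q j xor (σ ∧ V i₀ j)                       ≡⟨ rowSum-addMultiple V c (V i₀) Q j ⟨
        rowSum (λ i j → V i j xor (c i ∧ V i₀ j)) Q j       ≡⟨ Q-sum j ⟩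
        false                                               ∎
        where open ≡-Reasoning
      Q≡∅ : ∀ i → Q i ≡ false
      Q≡∅ i with ⁅ i₀ ⁆ i in e
      ... | false = begin
        Q i                  ≡⟨ xor-identityʳ (Q i) ⟨
        Q i xor false        ≡⟨ cong (Q i xor_) (∧-zeroʳ σ) ⟨
        Q i xor (σ ∧ false)  ≡⟨ cong (λ b → Q i xor (σ ∧ b)) e ⟨
        Q′ i                 ≡⟨ indep Q′ Q′⊆S Q′-sum i ⟩
        false                ∎
        where open ≡-Reasoning
      ... | true = subst (λ x → Q x ≡ false) (⁅⁆⇒≡ e) (⊆-false Q⊆ (remove-self S i₀))

    -- Induction on |R|: pick j₀ ∈ R; if some row i₀ ∈ S uses row j₀ of W, clear column j₀ of T by adding
    -- multiples of row i₀, then drop i₀ from S and j₀ from R.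
    exchange : ∀ k (W V T : Matrix m) (R S : Fin m → Bool) → countFin R ≡ k → LinIndepRows V S →
               (∀ i → S i ≡ true → Combination W R (T i) (V i)) → countFin S ≤ k
    exchange zero W V T R S |R|≡0 indep comb with countFin S in |S|
    ... | zero  = z≤n
    ... | suc _ = ⊥-elim (LinIndepRows⇒nonzero indep Si Vi≡0)
      where
      i = proj₁ (countFin≡suc⇒∃ S |S|)
      Si = proj₂ (countFin≡suc⇒∃ S |S|)
      Vi≡0 : ∀ j → V i j ≡ false
      Vi≡0 j = begin
        V i j             ≡⟨ proj₂ (comb i Si) j ⟨
        rowSum W (T i) j  ≡⟨ rowSum-cong W (λ l → ⊆-false (proj₁ (comb i Si)) (countFin≡0⇒∅ R |R|≡0 l)) j ⟩
        rowSum W ∅ j      ≡⟨ rowSum-∅ W j ⟩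
        false             ∎
        where open ≡-Reasoning
    exchange (suc k) W V T R S |R| indep comb = byPivot (any? (λ i → S i ∧ T i j₀ ≟ true))
      where
      j₀ = proj₁ (countFin≡suc⇒∃ R |R|)
      |R∖j₀| : countFin (remove R j₀) ≡ k
      |R∖j₀| = suc-injective (trans (sym (countFin-remove R j₀ (proj₂ (countFin≡suc⇒∃ R |R|)))) |R|)
      byPivot : Dec (∃ λ i → S i ∧ T i j₀ ≡ true) → countFin S ≤ suc k
      byPivot (no unused) = m≤n⇒m≤1+n (exchange k W V T (remove R j₀) S |R∖j₀| indep avoid)
        where
        avoid : ∀ i → S i ≡ true → Combination W (remove R j₀) (T i) (V i)
        avoid i Si = ⊆-remove (proj₁ (comb i Si)) (¬-not λ e → unused (i , trans (cong (_∧ T i j₀) Si) e)) , proj₂ (comb i Si)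
      byPivot (yes (i₀ , pivot)) = subst (_≤ suc k) (sym (countFin-remove S i₀ Si₀))
        (s≤s (exchange k W V′ T′ (remove R j₀) (remove S i₀) |R∖j₀| (LinIndepRows-addMultiple c indep Si₀) eliminate))
        where
        Si₀ = ∧-conicalˡ (S i₀) _ pivot
        c : Fin m → Bool
        c i = T i j₀
        V′ T′ : Matrix m
        V′ i j = V i j xor (c i ∧ V i₀ j)
        T′ i l = T i l xor (c i ∧ T i₀ l)
        eliminate : ∀ i → remove S i₀ i ≡ true → Combination W (remove R j₀) (T′ i) (V′ i)
        eliminate i e = combination-eliminate j₀ (comb i (remove-⊆ S i₀ i e)) (comb i₀ Si₀) (∧-conicalʳ (S i₀) _ pivot)

    Combination-cong : ∀ {W R T T′ u} → (∀ i → T i ≡ T′ i) → Combination W R T u → Combination W R T′ u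
    Combination-cong {W} {R} T≗T′ (T⊆R , sums) = (λ i e → T⊆R i (trans (T≗T′ i) e)) , λ j → trans (sym (rowSum-cong W T≗T′ j)) (sums j)

    combination? : ∀ W R T u → Dec (Combination W R T u)
    combination? W R T u = all? (λ i → (T i ≟ true) →-dec (R i ≟ true)) ×-dec all? (λ j → rowSum W T j ≟ u j)

    inSpan? : ∀ W R u → Dec (InSpan W R u)
    inSpan? W R u = map′ (λ (v , c) → lookup v , c) (λ (T , c) → tabulate T , Combination-cong (λ i → sym (lookup∘tabulate T i)) c)
                         (anySubset? (λ v → combination? W R (lookup v) u))

    InSpan-self : ∀ {W S i} → S i ≡ true → InSpan W S (W i)
    InSpan-self {W} {i = i} Si = ⁅ i ⁆ , ⁅⁆-⊆ Si , rowSum-⁅⁆ W i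

    remove≡xor⁅⁆ : ∀ {Q : Fin m → Bool} {i} → Q i ≡ true → ∀ k → remove Q i k ≡ Q k xor ⁅ i ⁆ k
    remove≡xor⁅⁆ {Q} {i} Qi k with ⁅ i ⁆ k in e
    ... | false = trans (∧-identityʳ (Q k)) (sym (xor-identityʳ (Q k)))
    ... | true = trans (∧-zeroʳ (Q k)) (cong (_xor true) (sym (subst (λ x → Q x ≡ true) (⁅⁆⇒≡ e) Qi)))

    LinIndepRows-∅ : ∀ {M : Matrix m} → LinIndepRows M ∅
    LinIndepRows-∅ Q Q⊆∅ _ i = ⊆-false Q⊆∅ refl

    LinIndepRows-insert : ∀ {M : Matrix m} {S i} → LinIndepRows M S → ¬ InSpan M S (M i) → LinIndepRows M (insert S i)
    LinIndepRows-insert {M} {S} {i} indep ∉span Q Q⊆ Q-sum = indep Q Q⊆S Q-sum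
      where
      ⊆S : ∀ {k} → Q k ≡ true → ⁅ i ⁆ k ≡ false → S k ≡ true
      ⊆S {k} Qk i≢k = trans (sym (∨-identityʳ (S k))) (trans (cong (S k ∨_) (sym i≢k)) (Q⊆ k Qk))
      Qi≡false : Q i ≡ false
      Qi≡false with Q i in Qi
      ... | false = refl
      ... | true = ⊥-elim (∉span (remove Q i , rest⊆S , rest-sum))
        where
        rest⊆S : remove Q i ⊆ S
        rest⊆S k e = ⊆S (∧-conicalˡ (Q k) _ e) (trans (sym (not-involutive _)) (cong not (∧-conicalʳ (Q k) _ e)))
        rest-sum : ∀ j → rowSum M (remove Q i) j ≡ M i j
        rest-sum j = begin
          rowSum M (remove Q i) j                   ≡⟨ rowSum-cong M (remove≡xor⁅⁆ {Q} Qi) j ⟩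
          rowSum M (λ k → Q k xor ⁅ i ⁆ k) j        ≡⟨ rowSum-xor M Q ⁅ i ⁆ j ⟩
          rowSum M Q j xor rowSum M ⁅ i ⁆ j         ≡⟨ cong₂ _xor_ (Q-sum j) (rowSum-⁅⁆ M i j) ⟩
          M i j                                     ∎
          where open ≡-Reasoning
      Q⊆S : Q ⊆ S
      Q⊆S k Qk with ⁅ i ⁆ k in e
      ... | false = ⊆S Qk e
      ... | true = ⊥-elim (true≢false (trans (sym Qk) (subst (λ x → Q x ≡ false) (⁅⁆⇒≡ e) Qi≡false)))

    module _ (M : Matrix m) where

      Spanning : (Fin m → Bool) → Set
      Spanning S = ∀ i → InSpan M S (M i)

      extendToSpanning : ∀ fuel S → LinIndepRows M S → m ≤ countFin S + fuel → Σ _ λ S′ → LinIndepRows M S′ × Spanning S′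
      extendToSpanning fuel S indep bound with all? (λ i → inSpan? M S (M i))
      ... | yes spanning = S , indep , spanning
      ... | no ¬spanning = extend fuel bound
        where
        i = proj₁ (¬∀⟶∃¬ m _ (λ i → inSpan? M S (M i)) ¬spanning)
        ∉span = proj₂ (¬∀⟶∃¬ m _ (λ i → inSpan? M S (M i)) ¬spanning)
        Si≡false : S i ≡ false
        Si≡false = ¬-not (λ Si → ∉span (InSpan-self Si))
        |S+i| = countFin-insert S i Si≡false
        extend : ∀ fuel → m ≤ countFin S + fuel → Σ _ λ S′ → LinIndepRows M S′ × Spanning S′
        extend zero bound = ⊥-elim (<-irrefl refl (≤-trans (subst (_≤ m) |S+i| (countFin-≤ (insert S i)))
                                                         (subst (m ≤_) (+-identityʳ _) bound)))
        extend (suc fuel) bound = extendToSpanning fuel (insert S i) (LinIndepRows-insert indep ∉span)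
                                    (subst (m ≤_) (trans (+-suc _ fuel) (cong (_+ fuel) (sym |S+i|))) bound)

      spanningIndependentRows : Σ _ λ S → LinIndepRows M S × Spanning S
      spanningIndependentRows = extendToSpanning m ∅ LinIndepRows-∅ (subst (λ c → m ≤ c + m) (sym (countFin-∅ {m})) ≤-refl)

    LinIndepRows-invertible : ∀ {B B′ : Matrix m} → B′ *ᴹ B ≈ᴹ 1ᴹ → ∀ S → LinIndepRows B′ S
    LinIndepRows-invertible {B} {B′} B′B≈1 S Q _ Q-sum i = begin
      Q i                                  ≡⟨ rowSum-1ᴹ Q i ⟨
      rowSum 1ᴹ Q i                        ≡⟨ rowSum-congᴹ (λ k l → sym (B′B≈1 k l)) Q i ⟩
      rowSum (B′ *ᴹ B) Q i                 ≡⟨ rowSum-*ᴹ B′ B Q i ⟩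
      rowSum B (λ l → rowSum B′ Q l) i     ≡⟨ rowSum-cong B Q-sum i ⟩
      rowSum B ∅ i                         ≡⟨ rowSum-∅ B i ⟩
      false                                ∎
      where open ≡-Reasoning

    LinIndepRows⇒countFin≤ : ∀ {M A′ B′ : Matrix m} e → M ≈ᴹ A′ *ᴹ (diagᴹ e *ᴹ B′) →
                             ∀ S → LinIndepRows M S → countFin S ≤ countFin e
    LinIndepRows⇒countFin≤ {M} {A′} {B′} e M≈A′DB′ S indep =
      exchange (countFin e) B′ M (λ i k → A′ i k ∧ e k) e S refl indep (λ i _ → viaB′ i)
      where
      viaB′ : ∀ i → Combination B′ e (λ k → A′ i k ∧ e k) (M i)
      viaB′ i = (λ k x → ∧-conicalʳ (A′ i k) _ x) , λ j → begin
        rowSum B′ (λ k → A′ i k ∧ e k) j       ≡⟨ rowSum≡sum B′ (λ k → A′ i k ∧ e k) j ⟩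
        ∑[ k < m ] ((A′ i k ∧ e k) ∧ B′ k j)   ≡⟨ sum-cong-≋ (λ k → ∧-assoc (A′ i k) (e k) (B′ k j)) ⟩
        ∑[ k < m ] (A′ i k ∧ (e k ∧ B′ k j))   ≡⟨ sum-cong-≋ (λ k → cong (A′ i k ∧_) (diagᴹ-*ᴹ e B′ k j)) ⟨
        (A′ *ᴹ (diagᴹ e *ᴹ B′)) i j             ≡⟨ M≈A′DB′ i j ⟨
        M i j                                   ∎
        where open ≡-Reasoning

    -- The rows of B′ selected by e are rows of A M, hence combinations of rows of M, hence of the rows indexed by S.
    Spanning⇒countFin≥ : ∀ {M A B B′ : Matrix m} e → B′ *ᴹ B ≈ᴹ 1ᴹ → diagᴹ e *ᴹ B′ ≈ᴹ A *ᴹ M →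
                         ∀ S → Spanning M S → countFin e ≤ countFin S
    Spanning⇒countFin≥ {M} {A} {B} {B′} e B′B≈1 DB′≈AM S spanning =
      exchange (countFin S) M B′ (A *ᴹ C) S e refl (LinIndepRows-invertible B′B≈1 e) viaS
      where
      C : Matrix m
      C i = proj₁ (spanning i)
      CM≈M : C *ᴹ M ≈ᴹ M
      CM≈M i j = trans (*ᴹ≡rowSum C M i j) (proj₂ (proj₂ (spanning i)) j)
      viaS : ∀ k → e k ≡ true → Combination M S ((A *ᴹ C) k) (B′ k)
      viaS k ek = support , sums
        where
        support : (A *ᴹ C) k ⊆ S
        support l x = rowSum-⊆ (λ i → proj₁ (proj₂ (spanning i))) (A k) l (trans (sym (*ᴹ≡rowSum A C k l)) x)
        sums : ∀ j → rowSum M ((A *ᴹ C) k) j ≡ B′ k j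
        sums j = begin
          rowSum M ((A *ᴹ C) k) j  ≡⟨ *ᴹ≡rowSum (A *ᴹ C) M k j ⟨
          (A *ᴹ C *ᴹ M) k j        ≡⟨ *ᴹ-assoc A C M k j ⟩
          (A *ᴹ (C *ᴹ M)) k j      ≡⟨ *ᴹ-congˡ A CM≈M k j ⟩
          (A *ᴹ M) k j             ≡⟨ DB′≈AM k j ⟨
          (diagᴹ e *ᴹ B′) k j      ≡⟨ diagᴹ-*ᴹ e B′ k j ⟩
          e k ∧ B′ k j             ≡⟨ cong (_∧ B′ k j) ek ⟩
          B′ k j                   ∎
          where open ≡-Reasoning

    HasRankF2-diagonalisable : ∀ {M A A′ B B′ : Matrix m} e → A′ *ᴹ A ≈ᴹ 1ᴹ → B *ᴹ B′ ≈ᴹ 1ᴹ → B′ *ᴹ B ≈ᴹ 1ᴹ →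
                               A *ᴹ M *ᴹ B ≈ᴹ diagᴹ e → HasRankF2 M (countFin e)
    HasRankF2-diagonalisable {M} {A} {A′} {B} {B′} e A′A≈1 BB′≈1 B′B≈1 AMB≈D =
      (S₀ , indep₀ , ≤-antisym (upper S₀ indep₀) (Spanning⇒countFin≥ e B′B≈1 DB′≈AM S₀ spanning₀)) , upper
      where
      open ≈ᴹ-Reasoning m
      D = diagᴹ e

      DB′≈AM : D *ᴹ B′ ≈ᴹ A *ᴹ M
      DB′≈AM = begin
        D *ᴹ B′              ≈⟨ *ᴹ-congʳ B′ AMB≈D ⟨
        A *ᴹ M *ᴹ B *ᴹ B′    ≈⟨ *ᴹ-assoc (A *ᴹ M) B B′ ⟩
        A *ᴹ M *ᴹ (B *ᴹ B′)  ≈⟨ *ᴹ-congˡ (A *ᴹ M) BB′≈1 ⟩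
        A *ᴹ M *ᴹ 1ᴹ         ≈⟨ *ᴹ-identityʳ (A *ᴹ M) ⟩
        A *ᴹ M               ∎

      M≈A′DB′ : M ≈ᴹ A′ *ᴹ (D *ᴹ B′)
      M≈A′DB′ = begin
        M                ≈⟨ *ᴹ-identityˡ M ⟨
        1ᴹ *ᴹ M          ≈⟨ *ᴹ-congʳ M A′A≈1 ⟨
        A′ *ᴹ A *ᴹ M     ≈⟨ *ᴹ-assoc A′ A M ⟩
        A′ *ᴹ (A *ᴹ M)   ≈⟨ *ᴹ-congˡ A′ DB′≈AM ⟨
        A′ *ᴹ (D *ᴹ B′)  ∎

      upper : ∀ S → LinIndepRows M S → countFin S ≤ countFin e
      upper = LinIndepRows⇒countFin≤ e M≈A′DB′

      S₀ = proj₁ (spanningIndependentRows M)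
      indep₀ = proj₁ (proj₂ (spanningIndependentRows M))
      spanning₀ = proj₂ (proj₂ (spanningIndependentRows M))

module SmithNormalForm where

  open import Data.Bool using (true; false; if_then_else_)
  open import Data.Nat as ℕ using (ℕ; zero; suc; _^_)
  open import Data.Nat.Divisibility using (_∣_; divides; ∣1⇒≡1; _∣?_; *-cancelˡ-∣)
  open import Data.Nat.Coprimality using (Coprime; coprime-divisor)
  open import Data.Nat.Primality using (prime?; prime⇒irreducible)
  import Data.Nat.Properties as ℕ
  open import Data.Integer as ℤ using (ℤ; +_; ∣_∣)
  open import Data.Integer.Properties using (+-*-commutativeSemiring; *-identityˡ; *-cancelʳ-≡; abs-*)
  open import Data.Fin using (Fin; zero; suc)
  open import Data.Fin.Properties using (_≟_)
  open import Data.Product using (∃; _,_; proj₁; proj₂)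
  open import Data.Sum using (inj₁; inj₂)
  open import Data.Empty using (⊥-elim)
  open import Relation.Binary.PropositionalEquality
  open import Relation.Nullary using (does; yes; no)
  open import Relation.Nullary.Decidable using (from-yes)

  open SquareMatrices +-*-commutativeSemiring public

  sumℤ≗sum : ∀ {m} (f : Fin m → ℤ) → sumℤ f ≡ sum f
  sumℤ≗sum {zero} f = refl
  sumℤ≗sum {suc m} f = cong (ℤ._+_ (f zero)) (sumℤ≗sum (λ i → f (suc i)))

  ⊛≈*ᴹ : ∀ {m} (X Y : Matrix m) → X ⊛ Y ≈ᴹ X *ᴹ Y
  ⊛≈*ᴹ X Y i j = sumℤ≗sum (λ k → X i k ℤ.* Y k j)

  module _ {m} {U : Matrix m} (unimodular : Unimodular U) where

    inverse : Matrix m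
    inverse = proj₁ unimodular

    inverse-*ᴹ : inverse *ᴹ U ≈ᴹ 1ᴹ
    inverse-*ᴹ i j = trans (sym (⊛≈*ᴹ inverse U i j)) (proj₂ (proj₂ unimodular) i j)

    *ᴹ-inverse : U *ᴹ inverse ≈ᴹ 1ᴹ
    *ᴹ-inverse i j = trans (sym (⊛≈*ᴹ U inverse i j)) (proj₁ (proj₂ unimodular) i j)

  ∣-of-cancellation : ∀ {n} (y c : ℤ) → n ≢ 0 → (+ n ℤ.* y) ℤ.* + n ≡ c ℤ.* + n → n ∣ ∣ c ∣
  ∣-of-cancellation {zero} y c n≢0 _ = ⊥-elim (n≢0 refl)
  ∣-of-cancellation {suc n} y c _ eq = divides ∣ y ∣ (begin
    ∣ c ∣                    ≡⟨ cong ∣_∣ (*-cancelʳ-≡ (+ suc n ℤ.* y) c (+ suc n) eq) ⟨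
    ∣ + suc n ℤ.* y ∣        ≡⟨ abs-* (+ suc n) y ⟩
    suc n ℕ.* ∣ y ∣          ≡⟨ ℕ.*-comm (suc n) ∣ y ∣ ⟩
    ∣ y ∣ ℕ.* suc n          ∎)
    where open ≡-Reasoning

  module _ {m} {N U V : Matrix m} {d : Fin m → ℕ} (snf : IsSNF N U V d) where

    SNF-diagonal : U *ᴹ N *ᴹ V ≈ᴹ diagᴹ (λ i → + d i)
    SNF-diagonal i j = begin
      (U *ᴹ N *ᴹ V) i j                             ≡⟨ *ᴹ-congʳ V (⊛≈*ᴹ U N) i j ⟨
      ((U ⊛ N) *ᴹ V) i j                            ≡⟨ ⊛≈*ᴹ (U ⊛ N) V i j ⟨
      ((U ⊛ N) ⊛ V) i j                             ≡⟨ proj₁ (proj₂ (proj₂ snf)) i j ⟩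
      (if does (i ≟ j) then + d i else + 0)         ≡⟨ if-scale (does (i ≟ j)) ⟩
      (if does (i ≟ j) then + 1 else + 0) ℤ.* + d i ∎
      where
      open ≡-Reasoning
      if-scale : ∀ b → (if b then + d i else + 0) ≡ (if b then + 1 else + 0) ℤ.* + d i
      if-scale true = sym (*-identityˡ (+ d i))
      if-scale false = refl

    U′ V′ : Matrix m
    U′ = inverse (proj₁ snf)
    V′ = inverse (proj₁ (proj₂ snf))

    private
      D : Matrix m
      D = diagᴹ (λ i → + d i)

    SNF-conjugate : ∀ X c → N *ᴹ X *ᴹ N ≈ᴹ c ·ᴹ N → D *ᴹ (V′ *ᴹ X *ᴹ U′) *ᴹ D ≈ᴹ c ·ᴹ D
    SNF-conjugate X c NXN≈cN = begin
      D *ᴹ Y *ᴹ D                              ≈⟨ *ᴹ-congʳ D (*ᴹ-congʳ Y SNF-diagonal) ⟨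
      E *ᴹ Y *ᴹ D                              ≈⟨ *ᴹ-congˡ (E *ᴹ Y) SNF-diagonal ⟨
      E *ᴹ (V′ *ᴹ X *ᴹ U′) *ᴹ E                ≈⟨ *ᴹ-congʳ E (*ᴹ-congˡ E (*ᴹ-assoc V′ X U′)) ⟩
      U *ᴹ N *ᴹ V *ᴹ (V′ *ᴹ (X *ᴹ U′)) *ᴹ E    ≈⟨ *ᴹ-congʳ E (*ᴹ-cancel-middle (*ᴹ-inverse (proj₁ (proj₂ snf))) (U *ᴹ N) (X *ᴹ U′)) ⟩
      U *ᴹ N *ᴹ (X *ᴹ U′) *ᴹ E                 ≈⟨ *ᴹ-congʳ E (*ᴹ-assoc (U *ᴹ N) X U′) ⟨
      U *ᴹ N *ᴹ X *ᴹ U′ *ᴹ E                   ≈⟨ *ᴹ-congˡ (U *ᴹ N *ᴹ X *ᴹ U′) (*ᴹ-assoc U N V) ⟩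
      U *ᴹ N *ᴹ X *ᴹ U′ *ᴹ (U *ᴹ (N *ᴹ V))     ≈⟨ *ᴹ-cancel-middle (inverse-*ᴹ (proj₁ snf)) (U *ᴹ N *ᴹ X) (N *ᴹ V) ⟩
      U *ᴹ N *ᴹ X *ᴹ (N *ᴹ V)                  ≈⟨ *ᴹ-assoc (U *ᴹ N *ᴹ X) N V ⟨
      U *ᴹ N *ᴹ X *ᴹ N *ᴹ V                    ≈⟨ *ᴹ-congʳ V (*ᴹ-congʳ N (*ᴹ-assoc U N X)) ⟩
      U *ᴹ (N *ᴹ X) *ᴹ N *ᴹ V                  ≈⟨ *ᴹ-congʳ V (*ᴹ-assoc U (N *ᴹ X) N) ⟩
      U *ᴹ (N *ᴹ X *ᴹ N) *ᴹ V                  ≈⟨ *ᴹ-congʳ V (*ᴹ-congˡ U NXN≈cN) ⟩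
      U *ᴹ c ·ᴹ N *ᴹ V                         ≈⟨ *ᴹ-congʳ V (*ᴹ-·ᴹ U N c) ⟩
      c ·ᴹ (U *ᴹ N) *ᴹ V                       ≈⟨ ·ᴹ-*ᴹ c (U *ᴹ N) V ⟩
      c ·ᴹ E                                   ≈⟨ (λ i j → cong (c ℤ.*_) (SNF-diagonal i j)) ⟩
      c ·ᴹ D                                   ∎
      where
      open ≈ᴹ-Reasoning m
      E = U *ᴹ N *ᴹ V
      Y = V′ *ᴹ X *ᴹ U′

    SNF-∣ : ∀ X c → N *ᴹ X *ᴹ N ≈ᴹ c ·ᴹ N → ∀ i → d i ≢ 0 → d i ∣ ∣ c ∣
    SNF-∣ X c NXN≈cN i dᵢ≢0 = ∣-of-cancellation (Y i i) c dᵢ≢0 (begin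
      (+ d i ℤ.* Y i i) ℤ.* + d i   ≡⟨ cong (ℤ._* + d i) (diagᴹ-*ᴹ (λ i → + d i) Y i i) ⟨
      (D *ᴹ Y) i i ℤ.* + d i        ≡⟨ *ᴹ-diagᴹ (D *ᴹ Y) (λ i → + d i) i i ⟨
      (D *ᴹ Y *ᴹ D) i i             ≡⟨ SNF-conjugate X c NXN≈cN i i ⟩
      c ℤ.* (1ᴹ i i ℤ.* + d i)      ≡⟨ cong (λ x → c ℤ.* (x ℤ.* + d i)) (1ᴹ-diagonal i) ⟩
      c ℤ.* (+ 1 ℤ.* + d i)         ≡⟨ cong (c ℤ.*_) (*-identityˡ (+ d i)) ⟩
      c ℤ.* + d i                   ∎)
      where
      open ≡-Reasoning
      Y = V′ *ᴹ X *ᴹ U′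

  ∣2^⇒≡2^ : ∀ k {d} → d ∣ 2 ^ k → ∃ λ e → d ≡ 2 ^ e
  ∣2^⇒≡2^ zero d∣1 = 0 , ∣1⇒≡1 d∣1
  ∣2^⇒≡2^ (suc k) {d} d∣2^k+1 with 2 ∣? d
  ... | yes (divides d′ refl) =
    let (e , d′≡2^e) = ∣2^⇒≡2^ k {d′} (*-cancelˡ-∣ 2 (subst (_∣ 2 ^ suc k) (ℕ.*-comm d′ 2) d∣2^k+1))
    in suc e , trans (ℕ.*-comm d′ 2) (cong (2 ℕ.*_) d′≡2^e)
  ... | no 2∤d = ∣2^⇒≡2^ k (coprime-divisor coprime d∣2^k+1)
    where
    coprime : Coprime d 2
    coprime (c∣d , c∣2) with prime⇒irreducible (from-yes (prime? 2)) c∣2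
    ... | inj₁ c≡1 = c≡1
    ... | inj₂ refl = ⊥-elim (2∤d c∣d)

module ReductionModTwo where

  open import Data.Bool using (Bool; true; false; _xor_; _∧_; not; if_then_else_)
  open import Data.Bool.Properties using (xor-assoc; xor-comm; xor-same; xor-identityʳ; not-involutive;
    not-distribˡ-xor; xor-annihilates-not)
  open import Data.Nat as ℕ using (ℕ; zero; suc; _+_; _*_; _∸_; _≤_; _^_; _≡ᵇ_)
  open import Data.Nat.Properties using (m∸n+n≡m; ≤-total; +-suc)
  open import Data.Integer as ℤ using (ℤ; +_; -[1+_]; ∣_∣; _⊖_)
  open import Data.Integer.Properties using (abs-*; ∣⊖∣-≤; ∣m⊖n∣≡∣n⊖m∣)
  open import Data.Fin using (Fin; zero; suc)
  open import Data.Fin.Properties using (_≟_)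
  open import Data.Product using (∃; _,_; proj₁; proj₂)
  open import Data.Sum using (inj₁; inj₂)
  open import Relation.Binary.PropositionalEquality
  open import Relation.Nullary using (does)
  module 𝔽₂ᴹ = RankOverF₂
  module ℤᴹ = SmithNormalForm

  parity : ℕ → Bool
  parity zero = false
  parity (suc n) = not (parity n)

  parity-+ : ∀ m n → parity (m + n) ≡ parity m xor parity n
  parity-+ zero n = refl
  parity-+ (suc m) n = trans (cong not (parity-+ m n)) (not-distribˡ-xor (parity m) (parity n))

  parity-* : ∀ m n → parity (m * n) ≡ parity m ∧ parity n
  parity-* zero n = refl
  parity-* (suc m) n = begin
    parity (n + m * n)                   ≡⟨ parity-+ n (m * n) ⟩
    parity n xor parity (m * n)          ≡⟨ cong (parity n xor_) (parity-* m n) ⟩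
    parity n xor (parity m ∧ parity n)   ≡⟨ absorb (parity m) (parity n) ⟩
    not (parity m) ∧ parity n            ∎
    where
    open ≡-Reasoning
    absorb : ∀ a b → b xor (a ∧ b) ≡ not a ∧ b
    absorb false b = xor-identityʳ b
    absorb true  b = xor-same b

  parity-∸ : ∀ {m n} → n ≤ m → parity (m ∸ n) ≡ parity m xor parity n
  parity-∸ {m} {n} n≤m = begin
    parity (m ∸ n)                           ≡⟨ xor-identityʳ _ ⟨
    parity (m ∸ n) xor false                 ≡⟨ cong (parity (m ∸ n) xor_) (xor-same (parity n)) ⟨
    parity (m ∸ n) xor (parity n xor parity n) ≡⟨ xor-assoc (parity (m ∸ n)) (parity n) (parity n) ⟨
    (parity (m ∸ n) xor parity n) xor parity n ≡⟨ cong (_xor parity n) (parity-+ (m ∸ n) n) ⟨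
    parity (m ∸ n + n) xor parity n          ≡⟨ cong (λ k → parity k xor parity n) (m∸n+n≡m n≤m) ⟩
    parity m xor parity n                    ∎
    where open ≡-Reasoning

  parity-⊖ : ∀ m n → parity ∣ m ⊖ n ∣ ≡ parity m xor parity n
  parity-⊖ m n with ≤-total m n
  ... | inj₁ m≤n = trans (cong parity (∣⊖∣-≤ m≤n)) (trans (parity-∸ m≤n) (xor-comm (parity n) (parity m)))
  ... | inj₂ n≤m = trans (cong parity (trans (∣m⊖n∣≡∣n⊖m∣ m n) (∣⊖∣-≤ n≤m))) (parity-∸ n≤m)

  parityᶻ : ℤ → Bool
  parityᶻ z = parity ∣ z ∣

  parityᶻ-+ : ∀ a b → parityᶻ (a ℤ.+ b) ≡ parityᶻ a xor parityᶻ b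
  parityᶻ-+ (+ m) (+ n) = parity-+ m n
  parityᶻ-+ (+ m) -[1+ n ] = parity-⊖ m (suc n)
  parityᶻ-+ -[1+ m ] (+ n) = trans (parity-⊖ n (suc m)) (xor-comm (parity n) (parity (suc m)))
  parityᶻ-+ -[1+ m ] -[1+ n ] = begin
    not (not (parity (m + n)))           ≡⟨ not-involutive _ ⟩
    parity (m + n)                       ≡⟨ parity-+ m n ⟩
    parity m xor parity n                ≡⟨ xor-annihilates-not (parity m) (parity n) ⟨
    not (parity m) xor not (parity n)    ∎
    where open ≡-Reasoning

  parityᶻ-* : ∀ a b → parityᶻ (a ℤ.* b) ≡ parityᶻ a ∧ parityᶻ b
  parityᶻ-* a b = trans (cong parity (abs-* a b)) (parity-* ∣ a ∣ ∣ b ∣)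

  parityᶻ-sum : ∀ {m} (f : Fin m → ℤ) → parityᶻ (ℤᴹ.sum f) ≡ 𝔽₂ᴹ.sum (λ i → parityᶻ (f i))
  parityᶻ-sum {zero} f = refl
  parityᶻ-sum {suc m} f = trans (parityᶻ-+ (f zero) _) (cong (parityᶻ (f zero) xor_) (parityᶻ-sum (λ i → f (suc i))))

  parity-2^ : ∀ e → parity (2 ^ e) ≡ (2 ^ e ≡ᵇ 1)
  parity-2^ zero = refl
  parity-2^ (suc e) = begin
    parity (2 * 2 ^ e)          ≡⟨ parity-* 2 (2 ^ e) ⟩
    false                       ≡⟨ double≢1 (2 ^ e) ⟨
    (2 * 2 ^ e ≡ᵇ 1)            ∎
    where
    open ≡-Reasoning
    double≢1 : ∀ k → (2 * k ≡ᵇ 1) ≡ false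
    double≢1 zero = refl
    double≢1 (suc k) rewrite +-suc k (k + 0) = refl

  reduce : ∀ {m} → ℤᴹ.Matrix m → 𝔽₂ᴹ.Matrix m
  reduce X i j = parityᶻ (X i j)

  reduce-cong : ∀ {m} {X Y : ℤᴹ.Matrix m} → X ℤᴹ.≈ᴹ Y → reduce X 𝔽₂ᴹ.≈ᴹ reduce Y
  reduce-cong X≈Y i j = cong parityᶻ (X≈Y i j)

  reduce-*ᴹ : ∀ {m} (X Y : ℤᴹ.Matrix m) → reduce (X ℤᴹ.*ᴹ Y) 𝔽₂ᴹ.≈ᴹ reduce X 𝔽₂ᴹ.*ᴹ reduce Y
  reduce-*ᴹ X Y i j = trans (parityᶻ-sum (λ k → X i k ℤ.* Y k j)) (𝔽₂ᴹ.sum-cong-≋ (λ k → parityᶻ-* (X i k) (Y k j)))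

  reduce-1ᴹ : ∀ {m} → reduce {m} ℤᴹ.1ᴹ 𝔽₂ᴹ.≈ᴹ 𝔽₂ᴹ.1ᴹ
  reduce-1ᴹ i j with does (i ≟ j)
  ... | true = refl
  ... | false = refl

  reduce-diagᴹ : ∀ {m} (d : Fin m → ℕ) → reduce (ℤᴹ.diagᴹ (λ i → + d i)) 𝔽₂ᴹ.≈ᴹ 𝔽₂ᴹ.diagᴹ (λ i → parity (d i))
  reduce-diagᴹ d i j = trans (parityᶻ-* (ℤᴹ.1ᴹ i j) (+ d i)) (cong (_∧ parity (d i)) (reduce-1ᴹ i j))

  reduce-inverse : ∀ {m} {X Y : ℤᴹ.Matrix m} → X ℤᴹ.*ᴹ Y ℤᴹ.≈ᴹ ℤᴹ.1ᴹ → reduce X 𝔽₂ᴹ.*ᴹ reduce Y 𝔽₂ᴹ.≈ᴹ 𝔽₂ᴹ.1ᴹ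
  reduce-inverse {X = X} {Y} XY≈1 i j = trans (sym (reduce-*ᴹ X Y i j)) (trans (reduce-cong XY≈1 i j) (reduce-1ᴹ i j))

  HasRankF2-SNF : ∀ {m} {N U V : ℤᴹ.Matrix m} {d} {M : 𝔽₂ᴹ.Matrix m} {e} → IsSNF N U V d →
                  reduce N 𝔽₂ᴹ.≈ᴹ M → (∀ i → parity (d i) ≡ e i) → HasRankF2 M (countFin e)
  HasRankF2-SNF {m} {N} {U} {V} {d} {M} {e} snf N≈M d≈e =
    𝔽₂ᴹ.HasRankF2-diagonalisable e
      (reduce-inverse {X = U′} {U} (ℤᴹ.inverse-*ᴹ (proj₁ snf)))
      (reduce-inverse {X = V} {V′} (ℤᴹ.*ᴹ-inverse (proj₁ (proj₂ snf))))
      (reduce-inverse {X = V′} {V} (ℤᴹ.inverse-*ᴹ (proj₁ (proj₂ snf))))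
      reduced
    where
    U′ = ℤᴹ.U′ snf
    V′ = ℤᴹ.V′ snf
    open 𝔽₂ᴹ using (_*ᴹ_; *ᴹ-congˡ; *ᴹ-congʳ; diagᴹ; 1ᴹ)
    reduced : reduce U *ᴹ M *ᴹ reduce V 𝔽₂ᴹ.≈ᴹ diagᴹ e
    reduced = begin
      reduce U *ᴹ M *ᴹ reduce V              ≈⟨ *ᴹ-congʳ (reduce V) (*ᴹ-congˡ (reduce U) N≈M) ⟨
      reduce U *ᴹ reduce N *ᴹ reduce V       ≈⟨ *ᴹ-congʳ (reduce V) (reduce-*ᴹ U N) ⟨
      reduce (U ℤᴹ.*ᴹ N) *ᴹ reduce V         ≈⟨ reduce-*ᴹ (U ℤᴹ.*ᴹ N) V ⟨
      reduce (U ℤᴹ.*ᴹ N ℤᴹ.*ᴹ V)             ≈⟨ reduce-cong (ℤᴹ.SNF-diagonal snf) ⟩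
      reduce (ℤᴹ.diagᴹ (λ i → + d i))        ≈⟨ reduce-diagᴹ d ⟩
      diagᴹ (λ i → parity (d i))             ≈⟨ (λ i j → cong (1ᴹ i j ∧_) (d≈e i)) ⟩
      diagᴹ e                                ∎
      where open 𝔽₂ᴹ.≈ᴹ-Reasoning m

  parityᶻ-indicator : ∀ b → parityᶻ (if b then + 1 else + 0) ≡ b
  parityᶻ-indicator true = refl
  parityᶻ-indicator false = refl

  parity-0-or-2^ : ∀ k → (k ≢ 0 → ∃ λ e → k ≡ 2 ^ e) → parity k ≡ (k ≡ᵇ 1)
  parity-0-or-2^ zero _ = refl
  parity-0-or-2^ (suc k) power =
    let (e , 1+k≡2^e) = power (λ ()) in subst (λ m → parity m ≡ (m ≡ᵇ 1)) (sym 1+k≡2^e) (parity-2^ e)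

module BentFunctions where

  open import Data.Bool using (Bool; true; false; _xor_; _∧_; not; if_then_else_)
  open import Data.Bool.Properties using (xor-assoc; xor-comm; xor-same; xor-identityˡ; xor-identityʳ)
  open import Data.Nat as ℕ using (ℕ; zero; suc; _^_; _∸_)
  import Data.Nat.Properties as ℕ
  open import Data.Integer as ℤ using (ℤ; +_; _+_; _*_; _-_)
  open import Data.Integer.Properties using (+-identityˡ; +-identityʳ; +-comm; *-identityˡ; *-identityʳ;
    *-assoc; *-distribˡ-+; *-distribʳ-+; pos-+; pos-*)
  open import Data.Integer.Tactic.RingSolver using (solve-∀)
  open import Data.Fin using (Fin; zero; suc; combine)
  open import Data.Fin.Properties using (remQuot-combine)
  open import Data.Vec using ([]; _∷_)
  open import Data.Vec.Properties using (zipWith-comm; zipWith-assoc; zipWith-identityˡ; zipWith-identityʳ)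
  open import Data.Product using (_×_; _,_)
  open import Data.Empty using (⊥-elim)
  open import Relation.Binary.PropositionalEquality
  open SmithNormalForm using (Matrix; sum; sum-cong-≋; ∑-distrib-+; *-distribˡ-sum; sum-combine; _*ᴹ_; _≈ᴹ_; _·ᴹ_; *ᴹ-congʳ)

  sumV : ∀ n → (F2^ n → ℤ) → ℤ
  sumV zero F = F []
  sumV (suc n) F = sumV n (λ x → F (false ∷ x)) + sumV n (λ x → F (true ∷ x))

  sum-bits : ∀ k (F : F2^ k → ℤ) → sum (λ i → F (bits k i)) ≡ sumV k F
  sum-bits zero F = +-identityʳ (F [])
  sum-bits (suc k) F = begin
    sum (λ i → F (bits (suc k) i))                                    ≡⟨ sum-combine 2 (2 ^ k) (λ i → F (bits (suc k) i)) ⟩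
    sum {2} (λ a → sum {2 ^ k} (λ b → F (bits (suc k) (combine a b)))) ≡⟨ sum-cong-≋ {2} (λ a → sum-cong-≋ {2 ^ k} (λ b → cong split (remQuot-combine a b))) ⟩
    sum {2} (λ a → sum {2 ^ k} (λ b → F (isOne a ∷ bits k b)))       ≡⟨ cong₂ _+_ (sum-bits k (λ x → F (false ∷ x))) (trans (+-identityʳ _) (sum-bits k (λ x → F (true ∷ x)))) ⟩
    sumV (suc k) F                                                    ∎
    where
    open ≡-Reasoning
    split : Fin 2 × Fin (2 ^ k) → ℤ
    split (a , b) = F (isOne a ∷ bits k b)

  sumV-cong : ∀ n {F G : F2^ n → ℤ} → (∀ x → F x ≡ G x) → sumV n F ≡ sumV n G
  sumV-cong zero F≗G = F≗G []
  sumV-cong (suc n) F≗G = cong₂ _+_ (sumV-cong n (λ x → F≗G (false ∷ x))) (sumV-cong n (λ x → F≗G (true ∷ x)))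

  sumV-+ : ∀ n (F G : F2^ n → ℤ) → sumV n (λ x → F x + G x) ≡ sumV n F + sumV n G
  sumV-+ n F G = begin
    sumV n (λ x → F x + G x)                               ≡⟨ sum-bits n (λ x → F x + G x) ⟨
    sum (λ i → F (bits n i) + G (bits n i))                ≡⟨ ∑-distrib-+ (λ i → F (bits n i)) (λ i → G (bits n i)) ⟩
    sum (λ i → F (bits n i)) + sum (λ i → G (bits n i))    ≡⟨ cong₂ _+_ (sum-bits n F) (sum-bits n G) ⟩
    sumV n F + sumV n G                                    ∎
    where open ≡-Reasoning

  sumV-const : ∀ n c → sumV n (λ _ → c) ≡ + (2 ^ n) * c
  sumV-const zero c = sym (*-identityˡ c)
  sumV-const (suc n) c = begin
    sumV n (λ _ → c) + sumV n (λ _ → c)    ≡⟨ cong₂ _+_ (sumV-const n c) (sumV-const n c) ⟩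
    + (2 ^ n) * c + + (2 ^ n) * c          ≡⟨ *-distribʳ-+ c (+ (2 ^ n)) (+ (2 ^ n)) ⟨
    (+ (2 ^ n) + + (2 ^ n)) * c            ≡⟨ cong (_* c) (pos-+ (2 ^ n) (2 ^ n)) ⟨
    + (2 ^ n ℕ.+ 2 ^ n) * c                ≡⟨ cong (λ k → + (2 ^ n ℕ.+ k) * c) (ℕ.+-identityʳ (2 ^ n)) ⟨
    + (2 ^ suc n) * c                      ∎
    where open ≡-Reasoning

  sumV-translate : ∀ n (F : F2^ n → ℤ) a → sumV n (λ x → F (x ⊕ a)) ≡ sumV n F
  sumV-translate zero F [] = refl
  sumV-translate (suc n) F (false ∷ a) =
    cong₂ _+_ (sumV-translate n (λ x → F (false ∷ x)) a) (sumV-translate n (λ x → F (true ∷ x)) a)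
  sumV-translate (suc n) F (true ∷ a) =
    trans (cong₂ _+_ (sumV-translate n (λ x → F (true ∷ x)) a) (sumV-translate n (λ x → F (false ∷ x)) a))
          (+-comm (sumV n (λ x → F (true ∷ x))) (sumV n (λ x → F (false ∷ x))))

  sumP : ∀ n → (Pt n → ℤ) → ℤ
  sumP n F = sumV n (λ x → F (x , false)) + sumV n (λ x → F (x , true))

  -- pt n i is bits (suc n) i with its first coordinate moved to the end.
  sum-pt : ∀ n (F : Pt n → ℤ) → sum (λ i → F (pt n i)) ≡ sumP n F
  sum-pt n F = sum-bits (suc n) (λ { (y ∷ x) → F (x , y) })

  sumP-cong : ∀ n {F G : Pt n → ℤ} → (∀ p → F p ≡ G p) → sumP n F ≡ sumP n G
  sumP-cong n F≗G = cong₂ _+_ (sumV-cong n (λ x → F≗G (x , false))) (sumV-cong n (λ x → F≗G (x , true)))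

  sumP-+ : ∀ n (F G : Pt n → ℤ) → sumP n (λ p → F p + G p) ≡ sumP n F + sumP n G
  sumP-+ n F G = begin
    sumP n (λ p → F p + G p)                             ≡⟨ sum-pt n (λ p → F p + G p) ⟨
    sum (λ i → F (pt n i) + G (pt n i))                  ≡⟨ ∑-distrib-+ (λ i → F (pt n i)) (λ i → G (pt n i)) ⟩
    sum (λ i → F (pt n i)) + sum (λ i → G (pt n i))      ≡⟨ cong₂ _+_ (sum-pt n F) (sum-pt n G) ⟩
    sumP n F + sumP n G                                  ∎
    where open ≡-Reasoning

  sumP-*ˡ : ∀ n c (F : Pt n → ℤ) → sumP n (λ p → c * F p) ≡ c * sumP n F
  sumP-*ˡ n c F = begin
    sumP n (λ p → c * F p)         ≡⟨ sum-pt n (λ p → c * F p) ⟨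
    sum (λ i → c * F (pt n i))     ≡⟨ *-distribˡ-sum c (λ i → F (pt n i)) ⟨
    c * sum (λ i → F (pt n i))     ≡⟨ cong (c *_) (sum-pt n F) ⟩
    c * sumP n F                   ∎
    where open ≡-Reasoning

  sumP-translate : ∀ n (F : Pt n → ℤ) g → sumP n (λ p → F (p ⊕ₚ g)) ≡ sumP n F
  sumP-translate n F (a , c) = sumV-translate (suc n) (λ { (y ∷ x) → F (x , y) }) (c ∷ a)

  ⊕-comm : ∀ {n} (x y : F2^ n) → x ⊕ y ≡ y ⊕ x
  ⊕-comm = zipWith-comm xor-comm

  ⊕-assoc : ∀ {n} (x y z : F2^ n) → (x ⊕ y) ⊕ z ≡ x ⊕ (y ⊕ z)
  ⊕-assoc = zipWith-assoc xor-assoc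

  ⊕-identityˡ : ∀ {n} (x : F2^ n) → zeroV ⊕ x ≡ x
  ⊕-identityˡ = zipWith-identityˡ xor-identityˡ

  ⊕-identityʳ : ∀ {n} (x : F2^ n) → x ⊕ zeroV ≡ x
  ⊕-identityʳ = zipWith-identityʳ xor-identityʳ

  ⊕-self : ∀ {n} (x : F2^ n) → x ⊕ x ≡ zeroV
  ⊕-self [] = refl
  ⊕-self (a ∷ x) = cong₂ _∷_ (xor-same a) (⊕-self x)

  ⊕ₚ-comm : ∀ {n} (p q : Pt n) → p ⊕ₚ q ≡ q ⊕ₚ p
  ⊕ₚ-comm (x , a) (y , b) = cong₂ _,_ (⊕-comm x y) (xor-comm a b)

  ⊕ₚ-assoc : ∀ {n} (p q r : Pt n) → (p ⊕ₚ q) ⊕ₚ r ≡ p ⊕ₚ (q ⊕ₚ r)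
  ⊕ₚ-assoc (x , a) (y , b) (z , c) = cong₂ _,_ (⊕-assoc x y z) (xor-assoc a b c)

  ⊕ₚ-cancelʳ : ∀ {n} (p q : Pt n) → (p ⊕ₚ q) ⊕ₚ q ≡ p
  ⊕ₚ-cancelʳ (x , a) (y , b) = cong₂ _,_
    (trans (⊕-assoc x y y) (trans (cong (x ⊕_) (⊕-self y)) (⊕-identityʳ x)))
    (trans (xor-assoc a b b) (trans (cong (a xor_) (xor-same b)) (xor-identityʳ a)))

  translationMatrix : ∀ {n} → (Pt n → ℤ) → Matrix (2 ^ suc n)
  translationMatrix {n} a i j = a (pt n j ⊕ₚ pt n i)

  infixl 7 _⋆_

  _⋆_ : ∀ {n} → (Pt n → ℤ) → (Pt n → ℤ) → Pt n → ℤ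
  _⋆_ {n} a b z = sumP n (λ q → a q * b (q ⊕ₚ z))

  translationMatrix-*ᴹ : ∀ {n} (a b : Pt n → ℤ) → translationMatrix a *ᴹ translationMatrix b ≈ᴹ translationMatrix (a ⋆ b)
  translationMatrix-*ᴹ {n} a b i j = begin
    sum (λ k → a (pt n k ⊕ₚ pᵢ) * b (pⱼ ⊕ₚ pt n k))   ≡⟨ sum-pt n G ⟩
    sumP n G                                          ≡⟨ sumP-translate n G pᵢ ⟨
    sumP n (λ q → G (q ⊕ₚ pᵢ))                        ≡⟨ sumP-cong n (λ q → cong₂ _*_ (cong a (⊕ₚ-cancelʳ q pᵢ)) (cong b (regroup q))) ⟩
    (a ⋆ b) (pⱼ ⊕ₚ pᵢ)                                 ∎
    where
    open ≡-Reasoning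
    pᵢ = pt n i
    pⱼ = pt n j
    G : Pt n → ℤ
    G p = a (p ⊕ₚ pᵢ) * b (pⱼ ⊕ₚ p)
    regroup : ∀ q → pⱼ ⊕ₚ (q ⊕ₚ pᵢ) ≡ q ⊕ₚ (pⱼ ⊕ₚ pᵢ)
    regroup q = trans (⊕ₚ-comm pⱼ (q ⊕ₚ pᵢ)) (trans (⊕ₚ-assoc q pᵢ pⱼ) (cong (q ⊕ₚ_) (⊕ₚ-comm pᵢ pⱼ)))

  indicator : Bool → ℤ
  indicator b = if b then + 1 else + 0

  sum-indicator : ∀ {m} (q : Fin m → Bool) → sum (λ i → indicator (q i)) ≡ + countFin q
  sum-indicator {zero} q = refl
  sum-indicator {suc m} q with q zero
  ... | true = trans (cong (_+_ (+ 1)) (sum-indicator (λ i → q (suc i)))) (sym (pos-+ 1 (countFin (λ i → q (suc i)))))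
  ... | false = trans (+-identityˡ _) (sum-indicator (λ i → q (suc i)))

  sumV-indicator : ∀ n (p : F2^ n → Bool) → sumV n (λ x → indicator (p x)) ≡ + countV n p
  sumV-indicator n p = trans (sym (sum-bits n (λ x → indicator (p x)))) (sum-indicator (λ i → p (bits n i)))

  isZero : ∀ {n} → F2^ n → Bool
  isZero [] = true
  isZero (x ∷ v) = not x ∧ isZero v

  isZero⇒≡zeroV : ∀ {n} (a : F2^ n) → isZero a ≡ true → a ≡ zeroV
  isZero⇒≡zeroV [] _ = refl
  isZero⇒≡zeroV (false ∷ a) e = cong (false ∷_) (isZero⇒≡zeroV a e)

  ¬isZero⇒≢zeroV : ∀ {n} (a : F2^ n) → isZero a ≡ false → a ≢ zeroV
  ¬isZero⇒≢zeroV (false ∷ a) e refl = ¬isZero⇒≢zeroV a e refl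

  sumV-isZero : ∀ n (u v : ℤ) → sumV n (λ a → if isZero a then u else v) ≡ u + (+ (2 ^ n) - + 1) * v
  sumV-isZero zero u v = sym (+-identityʳ u)
  sumV-isZero (suc n) u v = begin
    sumV n (λ a → if isZero a then u else v) + sumV n (λ _ → v) ≡⟨ cong₂ _+_ (sumV-isZero n u v) (sumV-const n v) ⟩
    u + (+ (2 ^ n) - + 1) * v + + (2 ^ n) * v                   ≡⟨ regroup u v (+ (2 ^ n)) ⟩
    u + (+ 2 * + (2 ^ n) - + 1) * v                             ≡⟨ cong (λ P → u + (P - + 1) * v) (pos-* 2 (2 ^ n)) ⟨
    u + (+ (2 ^ suc n) - + 1) * v                               ∎
    where
    open ≡-Reasoning
    regroup : ∀ u v P → u + (P - + 1) * v + P * v ≡ u + (+ 2 * P - + 1) * v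
    regroup = solve-∀

  double-2^∸1 : ∀ {n} (a : F2^ n) → a ≢ zeroV → 2 ℕ.* 2 ^ (n ∸ 1) ≡ 2 ^ n
  double-2^∸1 [] []≢0 = ⊥-elim ([]≢0 refl)
  double-2^∸1 (_ ∷ _) _ = refl

  module Graph (n : ℕ) (f : F2^ n → Bool) where

    graph : Pt n → ℤ
    graph p = indicator (inGraph n f p)

    P : ℤ
    P = + (2 ^ n)

    graph-fibre : ∀ w y → graph (w , y) + graph (w , not y) ≡ + 1
    graph-fibre w y with f w | y
    ... | true  | true  = refl
    ... | true  | false = refl
    ... | false | true  = refl
    ... | false | false = refl

    sumP-graph : sumP n graph ≡ P
    sumP-graph = begin
      sumP n graph                                     ≡⟨ sumV-+ n (λ x → graph (x , false)) (λ x → graph (x , true)) ⟨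
      sumV n (λ x → graph (x , false) + graph (x , true)) ≡⟨ sumV-cong n (λ x → graph-fibre x false) ⟩
      sumV n (λ _ → + 1)                               ≡⟨ sumV-const n (+ 1) ⟩
      P * + 1                                          ≡⟨ *-identityʳ P ⟩
      P                                                ∎
      where open ≡-Reasoning

    graph⋆graph-count : ∀ a b → (graph ⋆ graph) (a , b) ≡ sumV n (λ x → indicator (eqB (f (x ⊕ a) xor f x) b))
    graph⋆graph-count a b = begin
      (graph ⋆ graph) (a , b)                                  ≡⟨ sumV-+ n (λ x → G x false) (λ x → G x true) ⟨
      sumV n (λ x → G x false + G x true)                      ≡⟨ sumV-cong n (λ x → pointwise (f x) (f (x ⊕ a)) b) ⟩
      sumV n (λ x → indicator (eqB (f (x ⊕ a) xor f x) b))     ∎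
      where
      open ≡-Reasoning
      G : F2^ n → Bool → ℤ
      G x y = graph (x , y) * graph ((x , y) ⊕ₚ (a , b))
      pointwise : ∀ u v b → indicator (eqB u false) * indicator (eqB v (false xor b)) + indicator (eqB u true) * indicator (eqB v (true xor b))
                          ≡ indicator (eqB (v xor u) b)
      pointwise true  true  true  = refl
      pointwise true  true  false = refl
      pointwise true  false true  = refl
      pointwise true  false false = refl
      pointwise false true  true  = refl
      pointwise false true  false = refl
      pointwise false false true  = refl
      pointwise false false false = refl

    autocorrelation-zero : ∀ b → + 2 * (graph ⋆ graph) (zeroV , b) ≡ + 2 * (P * indicator (not b))
    autocorrelation-zero b = cong (+ 2 *_) (begin
      (graph ⋆ graph) (zeroV , b)                                   ≡⟨ graph⋆graph-count zeroV b ⟩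
      sumV n (λ x → indicator (eqB (f (x ⊕ zeroV) xor f x) b))      ≡⟨ sumV-cong n (λ x → cong (λ y → indicator (eqB (f y xor f x) b)) (⊕-identityʳ x)) ⟩
      sumV n (λ x → indicator (eqB (f x xor f x) b))                ≡⟨ sumV-cong n (λ x → cong (λ c → indicator (eqB c b)) (xor-same (f x))) ⟩
      sumV n (λ _ → indicator (not b))                              ≡⟨ sumV-const n (indicator (not b)) ⟩
      P * indicator (not b)                                         ∎)
      where open ≡-Reasoning

    autocorrelation-nonzero : IsBent n f → ∀ {a} → a ≢ zeroV → ∀ b → + 2 * (graph ⋆ graph) (a , b) ≡ P
    autocorrelation-nonzero bent {a} a≢0 b = begin
      + 2 * (graph ⋆ graph) (a , b)                                 ≡⟨ cong (+ 2 *_) (graph⋆graph-count a b) ⟩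
      + 2 * sumV n (λ x → indicator (eqB (f (x ⊕ a) xor f x) b))    ≡⟨ cong (+ 2 *_) (sumV-indicator n _) ⟩
      + 2 * + countV n (λ x → eqB (f (x ⊕ a) xor f x) b)            ≡⟨ cong (λ k → + 2 * + k) (bent a a≢0 b) ⟩
      + 2 * + (2 ^ (n ∸ 1))                                         ≡⟨ pos-* 2 (2 ^ (n ∸ 1)) ⟨
      + (2 ℕ.* 2 ^ (n ∸ 1))                                         ≡⟨ cong +_ (double-2^∸1 a a≢0) ⟩
      P                                                             ∎
      where open ≡-Reasoning

    autocorrelation⋆graph : IsBent n f → ∀ z → + 2 * (graph ⋆ graph ⋆ graph) z ≡ + 2 * P * graph z + (P - + 1) * P
    autocorrelation⋆graph bent z@(w , y) = begin
      + 2 * (graph ⋆ graph ⋆ graph) z                          ≡⟨ sumP-*ˡ n (+ 2) (λ q → (graph ⋆ graph) q * graph (q ⊕ₚ z)) ⟨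
      sumP n (λ q → + 2 * ((graph ⋆ graph) q * graph (q ⊕ₚ z))) ≡⟨ sumP-cong n (λ q → sym (*-assoc (+ 2) ((graph ⋆ graph) q) (graph (q ⊕ₚ z)))) ⟩
      sumP n (λ q → C q * graph (q ⊕ₚ z))                       ≡⟨ sumV-+ n (λ a → C (a , false) * graph ((a , false) ⊕ₚ z)) (λ a → C (a , true) * graph ((a , true) ⊕ₚ z)) ⟨
      sumV n (λ a → C (a , false) * graph ((a , false) ⊕ₚ z) + C (a , true) * graph ((a , true) ⊕ₚ z))
                                                               ≡⟨ sumV-cong n fibre ⟩
      sumV n (λ a → if isZero a then + 2 * P * graph z else P) ≡⟨ sumV-isZero n (+ 2 * P * graph z) P ⟩
      + 2 * P * graph z + (P - + 1) * P                        ∎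
      where
      open ≡-Reasoning
      C : Pt n → ℤ
      C q = + 2 * (graph ⋆ graph) q
      fibre : ∀ a → C (a , false) * graph ((a , false) ⊕ₚ z) + C (a , true) * graph ((a , true) ⊕ₚ z)
                    ≡ (if isZero a then + 2 * P * graph z else P)
      fibre a with isZero a in a≟0
      ... | true rewrite isZero⇒≡zeroV a a≟0 | ⊕-identityˡ w =
        trans (cong₂ (λ c c′ → c * graph (w , y) + c′ * graph (w , not y)) (autocorrelation-zero false) (autocorrelation-zero true))
              (simplify P (graph (w , y)) (graph (w , not y)))
        where
        simplify : ∀ P g g′ → + 2 * (P * + 1) * g + + 2 * (P * + 0) * g′ ≡ + 2 * P * g
        simplify = solve-∀
      ... | false = begin
        C (a , false) * graph (a ⊕ w , y) + C (a , true) * graph (a ⊕ w , not y)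
          ≡⟨ cong₂ (λ c c′ → c * graph (a ⊕ w , y) + c′ * graph (a ⊕ w , not y)) (autocorrelation-nonzero bent a≢0 false) (autocorrelation-nonzero bent a≢0 true) ⟩
        P * graph (a ⊕ w , y) + P * graph (a ⊕ w , not y)   ≡⟨ *-distribˡ-+ P _ _ ⟨
        P * (graph (a ⊕ w , y) + graph (a ⊕ w , not y))     ≡⟨ cong (P *_) (graph-fibre (a ⊕ w) y) ⟩
        P * + 1                                             ≡⟨ *-identityʳ P ⟩
        P                                                   ∎
        where a≢0 = ¬isZero⇒≢zeroV a a≟0

    quasiInverse : Pt n → ℤ
    quasiInverse q = + 2 * P * graph q + (+ 1 - P)

    graph⋆quasiInverse : ∀ z → (graph ⋆ quasiInverse) z ≡ + 2 * P * (graph ⋆ graph) z + (+ 1 - P) * P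
    graph⋆quasiInverse z = begin
      sumP n (λ q → graph q * quasiInverse (q ⊕ₚ z))
        ≡⟨ sumP-cong n (λ q → expand (graph q) (graph (q ⊕ₚ z)) (+ 2 * P) (+ 1 - P)) ⟩
      sumP n (λ q → + 2 * P * (graph q * graph (q ⊕ₚ z)) + (+ 1 - P) * graph q)
        ≡⟨ sumP-+ n (λ q → + 2 * P * (graph q * graph (q ⊕ₚ z))) (λ q → (+ 1 - P) * graph q) ⟩
      sumP n (λ q → + 2 * P * (graph q * graph (q ⊕ₚ z))) + sumP n (λ q → (+ 1 - P) * graph q)
        ≡⟨ cong₂ _+_ (sumP-*ˡ n (+ 2 * P) (λ q → graph q * graph (q ⊕ₚ z))) (trans (sumP-*ˡ n (+ 1 - P) graph) (cong ((+ 1 - P) *_) sumP-graph)) ⟩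
      + 2 * P * (graph ⋆ graph) z + (+ 1 - P) * P
        ∎
      where
      open ≡-Reasoning
      expand : ∀ g g′ a b → g * (a * g′ + b) ≡ a * (g * g′) + b * g
      expand = solve-∀

    graph⋆quasiInverse⋆graph : IsBent n f → ∀ z → (graph ⋆ quasiInverse ⋆ graph) z ≡ + 2 * P * P * graph z
    graph⋆quasiInverse⋆graph bent z = begin
      sumP n (λ q → (graph ⋆ quasiInverse) q * graph (q ⊕ₚ z))
        ≡⟨ sumP-cong n (λ q → trans (cong (_* graph (q ⊕ₚ z)) (graph⋆quasiInverse q)) (expand ((graph ⋆ graph) q) (graph (q ⊕ₚ z)) (+ 2 * P) ((+ 1 - P) * P))) ⟩
      sumP n (λ q → + 2 * P * ((graph ⋆ graph) q * graph (q ⊕ₚ z)) + (+ 1 - P) * P * graph (q ⊕ₚ z))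
        ≡⟨ sumP-+ n (λ q → + 2 * P * ((graph ⋆ graph) q * graph (q ⊕ₚ z))) (λ q → (+ 1 - P) * P * graph (q ⊕ₚ z)) ⟩
      sumP n (λ q → + 2 * P * ((graph ⋆ graph) q * graph (q ⊕ₚ z))) + sumP n (λ q → (+ 1 - P) * P * graph (q ⊕ₚ z))
        ≡⟨ cong₂ _+_ (sumP-*ˡ n (+ 2 * P) (λ q → (graph ⋆ graph) q * graph (q ⊕ₚ z)))
                     (trans (sumP-*ˡ n ((+ 1 - P) * P) (λ q → graph (q ⊕ₚ z))) (cong ((+ 1 - P) * P *_) (trans (sumP-translate n graph z) sumP-graph))) ⟩
      + 2 * P * (graph ⋆ graph ⋆ graph) z + (+ 1 - P) * P * P
        ≡⟨ cong (_+ (+ 1 - P) * P * P) (double P ((graph ⋆ graph ⋆ graph) z)) ⟩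
      P * (+ 2 * (graph ⋆ graph ⋆ graph) z) + (+ 1 - P) * P * P
        ≡⟨ cong (λ t → P * t + (+ 1 - P) * P * P) (autocorrelation⋆graph bent z) ⟩
      P * (+ 2 * P * graph z + (P - + 1) * P) + (+ 1 - P) * P * P
        ≡⟨ collapse P (graph z) ⟩
      + 2 * P * P * graph z
        ∎
      where
      open ≡-Reasoning
      expand : ∀ c g a b → (a * c + b) * g ≡ a * (c * g) + b * g
      expand = solve-∀
      double : ∀ P X → + 2 * P * X ≡ P * (+ 2 * X)
      double = solve-∀
      collapse : ∀ P g → P * (+ 2 * P * g + (P - + 1) * P) + (+ 1 - P) * P * P ≡ + 2 * P * P * g
      collapse = solve-∀

    2^[1+n+n]≡2PP : + (2 ^ suc (n ℕ.+ n)) ≡ + 2 * P * P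
    2^[1+n+n]≡2PP = begin
      + (2 ℕ.* 2 ^ (n ℕ.+ n))        ≡⟨ cong (λ k → + (2 ℕ.* k)) (ℕ.^-distribˡ-+-* 2 n n) ⟩
      + (2 ℕ.* (2 ^ n ℕ.* 2 ^ n))    ≡⟨ cong +_ (ℕ.*-assoc 2 (2 ^ n) (2 ^ n)) ⟨
      + (2 ℕ.* 2 ^ n ℕ.* 2 ^ n)      ≡⟨ pos-* (2 ℕ.* 2 ^ n) (2 ^ n) ⟩
      + (2 ℕ.* 2 ^ n) * P            ≡⟨ cong (_* P) (pos-* 2 (2 ^ n)) ⟩
      + 2 * P * P                    ∎
      where open ≡-Reasoning

    -- Nf n f is definitionally translationMatrix graph.
    Nf-quasiInverse : IsBent n f → Nf n f *ᴹ translationMatrix quasiInverse *ᴹ Nf n f ≈ᴹ (+ (2 ^ suc (n ℕ.+ n))) ·ᴹ Nf n f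
    Nf-quasiInverse bent i j = begin
      (Nf n f *ᴹ translationMatrix quasiInverse *ᴹ Nf n f) i j              ≡⟨ *ᴹ-congʳ (Nf n f) (translationMatrix-*ᴹ graph quasiInverse) i j ⟩
      (translationMatrix (graph ⋆ quasiInverse) *ᴹ translationMatrix graph) i j ≡⟨ translationMatrix-*ᴹ (graph ⋆ quasiInverse) graph i j ⟩
      (graph ⋆ quasiInverse ⋆ graph) (pt n j ⊕ₚ pt n i)                      ≡⟨ graph⋆quasiInverse⋆graph bent (pt n j ⊕ₚ pt n i) ⟩
      + 2 * P * P * graph (pt n j ⊕ₚ pt n i)                                 ≡⟨ cong (_* graph (pt n j ⊕ₚ pt n i)) 2^[1+n+n]≡2PP ⟨
      + (2 ^ suc (n ℕ.+ n)) * Nf n f i j                                    ∎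
      where open ≡-Reasoning

open import Data.Nat using (_+_)
open import Data.Integer using (+_)
open import Data.Product using (_,_)
open SmithNormalForm using (SNF-∣; ∣2^⇒≡2^)
open ReductionModTwo using (HasRankF2-SNF; parityᶻ-indicator; parity-0-or-2^)
open BentFunctions using (translationMatrix; module Graph)

mainTheorem2 : (n : ℕ) (f : F2^ n → Bool) → IsBent n f →
    (U V : Mat ℤ (2 ^ suc n)) (d : Fin (2 ^ suc n) → ℕ) → IsSNF (Nf n f) U V d →
    (∀ i → d i ≢ 0 → ∃ λ e → d i ≡ 2 ^ e) ×
    HasRankF2 (NfB n f) (countFin (λ i → d i ≡ᵇ 1))
mainTheorem2 n f bent U V d snf = powersOfTwo , rank
  where
  open Graph n f using (quasiInverse; Nf-quasiInverse)
  powersOfTwo : ∀ i → d i ≢ 0 → ∃ λ e → d i ≡ 2 ^ e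
  powersOfTwo i dᵢ≢0 = ∣2^⇒≡2^ (suc (n + n))
    (SNF-∣ snf (translationMatrix quasiInverse) (+ (2 ^ suc (n + n))) (Nf-quasiInverse bent) i dᵢ≢0)
  rank : HasRankF2 (NfB n f) (countFin (λ i → d i ≡ᵇ 1))
  rank = HasRankF2-SNF snf (λ i j → parityᶻ-indicator (NfB n f i j)) (λ i → parity-0-or-2^ (d i) (powersOfTwo i))
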